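{- Let $n\geq 5$ and let $\pi=(d_1,d_2,\dots,d_n)$ be a graphic sequence with $d_1\geq d_2\geq\cdots\geq d_n\geq 1$. Then $\pi$ is potentially $(K_5-Y_4)$-graphic if and only if all of the following hold: (1) $d_3\geq 3$; (2) $d_4\geq 2$; (3) $\pi\neq(3^6)$.
   Context: All graphs are finite and simple. A nonincreasing sequence of nonnegative integers is graphic if it is the degree sequence of some simple graph (a realization). A graphic sequence $\pi$ is potentially $H$-graphic if it has a realization containing $H$ as a (not necessarily induced) subgraph. In a sequence, $r^t$ denotes $t$ consecutive terms equal to $r$ (so $(3^6)=(3,3,3,3,3,3)$). $Y_4$ denotes the tree on $5$ vertices with exactly $3$ leaves, and $K_5-Y_4$ is the graph obtained from $K_5$ by deleting the edge set of a copy of $Y_4$ spanning its 5 vertices. -}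

module Defs where

open import Data.Nat using (ℕ; zero; suc; _+_; _≤_)
open import Data.Bool using (Bool; true; false; if_then_else_)
open import Data.Fin using (Fin; zero; suc)
import Data.Fin as F
open import Data.List using (List; []; _∷_; map; allFin)
open import Data.Nat.ListAction using (sum)
open import Data.List.Membership.Propositional using (_∈_)
open import Data.Product using (Σ; _×_; _,_; ∃)
open import Relation.Binary.PropositionalEquality using (_≡_)
open import Function.Definitions using (Injective)

record Graph (n : ℕ) : Set where
  field
    adj    : Fin n → Fin n → Bool
    sym    : ∀ i j → adj i j ≡ adj j i
    irrefl : ∀ i → adj i i ≡ false
open Graph public

deg : ∀ {n} → Graph n → Fin n → ℕ
deg {n} G i = sum (map (λ j → if adj G i j then 1 else 0) (allFin n))

-- a sequence of length n (d i is the (i+1)-th term)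
Seq : ℕ → Set
Seq n = Fin n → ℕ

NonIncreasing : ∀ {n} → Seq n → Set
NonIncreasing {n} d = ∀ (i j : Fin n) → i F.≤ j → d j ≤ d i

Realizes : ∀ {n} → Graph n → Seq n → Set
Realizes {n} G d = ∀ (i : Fin n) → deg G i ≡ d i

Graphic : ∀ {n} → Seq n → Set
Graphic {n} d = Σ (Graph n) λ G → Realizes G d

ContainsSubgraph : ∀ {n k} → Graph n → List (Fin k × Fin k) → Set
ContainsSubgraph {n} {k} G edgesH =
  Σ (Fin k → Fin n) λ f → Injective _≡_ _≡_ f ×
    (∀ a b → (a , b) ∈ edgesH → adj G (f a) (f b) ≡ true)

-- Y₄: the tree on {0,1,2,3,4} with edges 01, 12, 23, 14 (exactly 3 leaves: 0, 3, 4).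
-- K₅ - Y₄: the remaining 6 edges of K₅.
K5-Y4 : List (Fin 5 × Fin 5)
K5-Y4 = (v0 , v2) ∷ (v0 , v3) ∷ (v0 , v4) ∷ (v1 , v3) ∷ (v2 , v4) ∷ (v3 , v4) ∷ []
  where
  v0 v1 v2 v3 v4 : Fin 5
  v0 = zero
  v1 = suc zero
  v2 = suc (suc zero)
  v3 = suc (suc (suc zero))
  v4 = suc (suc (suc (suc zero)))

PotentiallyGraphic : ∀ {n k} → List (Fin k × Fin k) → Seq n → Set
PotentiallyGraphic {n} H d = Σ (Graph n) λ G → Realizes G d × ContainsSubgraph G H

-- Call a vertex large if its degree is at least 3. K₅ − Y₄ is a diamond (K₄ minus an edge) with a pendant edge
-- at one of its tips, so a copy provides three large vertices and a fourth of degree at least 2, and in a 3-regular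
-- graph on six vertices the copy leaves no room for the neighbours of the sixth vertex.
-- Conversely, 2-switches preserve degrees. Starting from three large vertices, switches produce an edge, then a
-- cherry, then a triangle of large vertices; with a vertex of degree at least 2 off the triangle they produce a
-- diamond with a large tip, and then a pendant edge at that tip. The only obstruction is a triangle whose outside
-- neighbours close up into a prism: if the prism is not the whole graph an edge elsewhere is switched into it,
-- and if it is, the sequence is (3⁶).

module Submission where

open import Defs hiding (sym)
open import Data.Bool using (Bool; true; false; if_then_else_; _∨_)
open import Data.Bool.Properties using (¬-not) renaming (_≟_ to _≟ᵇ_)
open import Data.Empty using (⊥; ⊥-elim)
open import Data.Fin using (Fin; zero; suc; toℕ; fromℕ<; inject≤)
open import Data.Fin.Properties using (_≟_; any?; toℕ-injective; toℕ-fromℕ<; toℕ-inject≤)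
open import Data.List using (List; []; _∷_; length; tabulate)
open import Data.List.Properties using (map-tabulate; length-tabulate)
open import Data.List.Membership.Propositional.Properties using (∈-tabulate⁺; ∉[])
open import Data.List.Membership.Propositional using (_∈_)
open import Data.List.Relation.Unary.All using (All; []; _∷_)
import Data.List.Relation.Unary.All as All
open import Data.List.Relation.Unary.All.Properties using (¬Any⇒All¬; All¬⇒¬Any; ++⁺)
open import Data.List.Relation.Unary.Any using (here; there)
import Data.List.Relation.Unary.Any as Any
open import Data.List.Relation.Unary.Unique.Propositional using (Unique; []; _∷_)
open import Data.List.Relation.Unary.Unique.Propositional.Properties using (take⁺)
open import Data.Vec using (Vec; []; _∷_; lookup)
open import Data.Vec.Relation.Unary.All using ([]; _∷_)
open import Data.Vec.Relation.Unary.AllPairs using ([]; _∷_)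
open import Data.Vec.Relation.Unary.Unique.Propositional using () renaming (Unique to UniqueV)
open import Data.Vec.Relation.Unary.Unique.Propositional.Properties using (lookup-injective)
open import Data.Nat using (ℕ; zero; suc; _+_; _≤_; _<_; z≤n; s≤s)
open import Data.Nat.ListAction using (sum)
open import Data.Nat.Properties
  using (+-assoc; +-comm; +-mono-≤; ≤-reflexive; ≤-refl; ≤-trans; <-≤-trans; ≤-antisym; <⇒≱; <⇒≤; ≰⇒>; _≤?_; n≤1+n; m≤m+n)
open import Data.Product using (Σ; ∃; _×_; _,_)
open import Data.Sum using (_⊎_; inj₁; inj₂)
open import Function using (_∘_; const)
open import Function.Bundles using (_⇔_; mk⇔)
open import Relation.Binary.PropositionalEquality
  using (_≡_; _≢_; refl; sym; trans; cong; cong₂; subst; ≢-sym; module ≡-Reasoning)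
open import Relation.Nullary using (¬_; Dec; yes; no; does)
open import Relation.Nullary.Decidable using (dec-true; dec-false; does-≡; map′; _×-dec_; _⊎-dec_; ¬?)

indicator : Bool → ℕ
indicator b = if b then 1 else 0

count : ∀ {n} → (Fin n → Bool) → ℕ
count r = sum (tabulate (indicator ∘ r))

deg≡count : ∀ {n} (G : Graph n) i → deg G i ≡ count (adj G i)
deg≡count G i = cong sum (map-tabulate (λ j → j) (λ j → indicator (adj G i j)))

count-const-true : ∀ n → count {n} (const true) ≡ n
count-const-true zero    = refl
count-const-true (suc n) = cong suc (count-const-true n)

count-cong : ∀ {n} {r s : Fin n → Bool} → (∀ j → r j ≡ s j) → count r ≡ count s
count-cong {zero}          r≗s = refl
count-cong {suc n} {r} {s} r≗s = cong₂ _+_ (cong indicator (r≗s zero)) (count-cong (r≗s ∘ suc))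

erase : ∀ {n} → (Fin n → Bool) → Fin n → Fin n → Bool
erase r p j = if does (j ≟ p) then false else r j

erase-off : ∀ {n} (r : Fin n → Bool) {p j} → j ≢ p → erase r p j ≡ r j
erase-off r {p} {j} j≢p rewrite dec-false (j ≟ p) j≢p = refl

count-erase : ∀ {n} (r : Fin n → Bool) p → count r ≡ indicator (r p) + count (erase r p)
count-erase r zero    = refl
count-erase r (suc p) = begin
  indicator (r zero) + count (r ∘ suc)
    ≡⟨ cong (indicator (r zero) +_) (count-erase (r ∘ suc) p) ⟩
  indicator (r zero) + (indicator (r (suc p)) + count (erase (r ∘ suc) p))
    ≡⟨ sym (+-assoc (indicator (r zero)) _ _) ⟩
  indicator (r zero) + indicator (r (suc p)) + count (erase (r ∘ suc) p)
    ≡⟨ cong (_+ count (erase (r ∘ suc) p)) (+-comm (indicator (r zero)) _) ⟩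
  indicator (r (suc p)) + indicator (r zero) + count (erase (r ∘ suc) p)
    ≡⟨ +-assoc (indicator (r (suc p))) _ _ ⟩
  indicator (r (suc p)) + count (erase r (suc p)) ∎
  where open ≡-Reasoning

count-≥-length : ∀ {n} (r : Fin n → Bool) {L} → Unique L → All (λ j → r j ≡ true) L → length L ≤ count r
count-≥-length r {[]}    _              _           = z≤n
count-≥-length r {a ∷ L} (a∉L ∷ uniq) (ra ∷ rL) rewrite count-erase r a | ra =
  s≤s (count-≥-length (erase r a) uniq (All.zipWith erased (a∉L , rL)))
  where
  erased : ∀ {j} → a ≢ j × r j ≡ true → erase r a j ≡ true
  erased (a≢j , rj) = trans (erase-off r (≢-sym a≢j)) rj

count-false : ∀ {n} (r : Fin n → Bool) → (∀ j → r j ≡ false) → count r ≡ 0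
count-false {zero}  r r≗false = refl
count-false {suc n} r r≗false rewrite r≗false zero = count-false (r ∘ suc) (r≗false ∘ suc)

count-≤-length : ∀ {n} (r : Fin n → Bool) (L : List (Fin n)) → (∀ j → r j ≡ true → j ∈ L) → count r ≤ length L
count-≤-length r [] covered = ≤-reflexive (count-false r (λ j → ¬-not (∉[] ∘ covered j)))
count-≤-length r (a ∷ L) covered rewrite count-erase r a =
  +-mono-≤ (indicator≤1 (r a)) (count-≤-length (erase r a) L covered′)
  where
  indicator≤1 : ∀ b → indicator b ≤ 1
  indicator≤1 true  = s≤s z≤n
  indicator≤1 false = z≤n
  covered′ : ∀ j → erase r a j ≡ true → j ∈ L
  covered′ j e with j ≟ a
  covered′ j () | yes refl
  covered′ j e  | no j≢a with covered j e
  ... | here j≡a = ⊥-elim (j≢a j≡a)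
  ... | there j∈L = j∈L

covered-or-escapes : ∀ {n} (r : Fin n → Bool) (L : List (Fin n)) →
                     (∀ j → r j ≡ true → j ∈ L) ⊎ ∃ λ j → r j ≡ true × All (j ≢_) L
covered-or-escapes r L with any? (λ j → (r j ≟ᵇ true) ×-dec ¬? (Any.any? (j ≟_) L))
... | yes (j , rj , j∉L) = inj₂ (j , rj , ¬Any⇒All¬ L j∉L)
... | no none = inj₁ covered
  where
  covered : ∀ j → r j ≡ true → j ∈ L
  covered j rj with Any.any? (j ≟_) L
  ... | yes j∈L = j∈L
  ... | no  j∉L = ⊥-elim (none (j , rj , j∉L))

escapes : ∀ {n} (r : Fin n → Bool) (L : List (Fin n)) → length L < count r → ∃ λ j → r j ≡ true × All (j ≢_) L
escapes r L L<r with covered-or-escapes r L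
... | inj₂ escape  = escape
... | inj₁ covered = ⊥-elim (<⇒≱ L<r (count-≤-length r L covered))

count-swap : ∀ {n} (r r′ : Fin n → Bool) {p q} → p ≢ q →
             r p ≡ true → r q ≡ false → r′ p ≡ false → r′ q ≡ true →
             (∀ j → j ≢ p → j ≢ q → r′ j ≡ r j) → count r′ ≡ count r
count-swap r r′ {p} {q} p≢q rp rq r′p r′q agree = begin
  count r′                                      ≡⟨ count-erase₂ r′ ⟩
  indicator (r′ p) + indicator (r′ q) + rest r′ ≡⟨ cong₂ (λ a b → a + b + rest r′) (cong indicator r′p) (cong indicator r′q) ⟩
  1 + rest r′                                   ≡⟨ cong suc (count-cong erased-agree) ⟩
  1 + rest r                                    ≡⟨ cong₂ (λ a b → a + b + rest r) (cong indicator rp) (cong indicator rq) ⟨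
  indicator (r p) + indicator (r q) + rest r    ≡⟨ count-erase₂ r ⟨
  count r                                       ∎
  where
  open ≡-Reasoning
  rest : (Fin _ → Bool) → ℕ
  rest s = count (erase (erase s p) q)
  count-erase₂ : ∀ s → count s ≡ indicator (s p) + indicator (s q) + rest s
  count-erase₂ s = begin
    count s                                              ≡⟨ count-erase s p ⟩
    indicator (s p) + count (erase s p)                  ≡⟨ cong (indicator (s p) +_) (count-erase (erase s p) q) ⟩
    indicator (s p) + (indicator (erase s p q) + rest s)
      ≡⟨ cong (λ b → indicator (s p) + (indicator b + rest s)) (erase-off s (≢-sym p≢q)) ⟩
    indicator (s p) + (indicator (s q) + rest s)         ≡⟨ +-assoc (indicator (s p)) (indicator (s q)) (rest s) ⟨
    indicator (s p) + indicator (s q) + rest s           ∎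
  erased-agree : ∀ j → erase (erase r′ p) q j ≡ erase (erase r p) q j
  erased-agree j with j ≟ p | j ≟ q
  ... | _      | yes _  = refl
  ... | yes _  | no _   = refl
  ... | no j≢p | no j≢q = agree j j≢p j≢q

vertex-outside : ∀ {n} (L : List (Fin n)) → length L < n → ∃ λ u → All (u ≢_) L
vertex-outside {n} L L<n with escapes (const true) L (subst (length L <_) (sym (count-const-true n)) L<n)
... | u , _ , u∉L = u , u∉L

avoids? : ∀ {n} (a : Fin n) (L : List (Fin n)) → Dec (All (a ≢_) L)
avoids? a = All.all? (λ u → ¬? (a ≟ u))

vertices-covered-or-escape : ∀ {n} (L : List (Fin n)) → (∀ u → u ∈ L) ⊎ ∃ λ u → All (u ≢_) L
vertices-covered-or-escape L with covered-or-escapes (const true) L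
... | inj₁ covered          = inj₁ (λ u → covered u refl)
... | inj₂ (u , _ , u∉L)    = inj₂ (u , u∉L)

unique⇒length≤ : ∀ {n} {L : List (Fin n)} → Unique L → length L ≤ n
unique⇒length≤ {n} {L} uniq = subst (length L ≤_) (count-const-true n) (count-≥-length (const true) uniq (All.universal (λ _ → refl) _))

covering⇒length≥ : ∀ {n} (L : List (Fin n)) → (∀ u → u ∈ L) → n ≤ length L
covering⇒length≥ {n} L covering = subst (_≤ length L) (count-const-true n) (count-≤-length (const true) L (λ u _ → covering u))

module _ {n : ℕ} where

  record Edge (G : Graph n) (x y : Fin n) : Set where
    constructor edge
    field adjacent : adj G x y ≡ true

  record NonEdge (G : Graph n) (x y : Fin n) : Set where
    constructor nonEdge
    field nonadjacent : adj G x y ≡ false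

  open Edge public
  open NonEdge public

  edge? : ∀ G x y → Dec (Edge G x y)
  edge? G x y = map′ edge adjacent (adj G x y ≟ᵇ true)

  edge-or-nonEdge : ∀ G x y → Edge G x y ⊎ NonEdge G x y
  edge-or-nonEdge G x y with adj G x y in xy
  ... | true  = inj₁ (edge xy)
  ... | false = inj₂ (nonEdge xy)

  ¬edge⇒nonEdge : ∀ {G x y} → ¬ Edge G x y → NonEdge G x y
  ¬edge⇒nonEdge ¬xy = nonEdge (¬-not (¬xy ∘ edge))

  edge-sym : ∀ {G x y} → Edge G x y → Edge G y x
  edge-sym {G} {x} {y} (edge xy) = edge (trans (Graph.sym G y x) xy)

  nonEdge-sym : ∀ {G x y} → NonEdge G x y → NonEdge G y x
  nonEdge-sym {G} {x} {y} (nonEdge x≁y) = nonEdge (trans (Graph.sym G y x) x≁y)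

  edge-nonEdge-⊥ : ∀ {G x y} → Edge G x y → NonEdge G x y → ⊥
  edge-nonEdge-⊥ (edge xy) (nonEdge x≁y) with trans (sym xy) x≁y
  ... | ()

  edge⇒≢ : ∀ {G x y} → Edge G x y → x ≢ y
  edge⇒≢ {G} {x} xy refl = edge-nonEdge-⊥ xy (nonEdge (irrefl G x))

  edge-nonEdge⇒≢ : ∀ {G x y z} → Edge G x y → NonEdge G x z → y ≢ z
  edge-nonEdge⇒≢ xy x≁z refl = edge-nonEdge-⊥ xy x≁z

  infix 4 N[_∣_]⊆_
  N[_∣_]⊆_ : Graph n → Fin n → List (Fin n) → Set
  N[ G ∣ x ]⊆ L = ∀ j → Edge G x j → j ∈ L

  neighbours-covered-or-escape : ∀ G x (L : List (Fin n)) →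
                                 (N[ G ∣ x ]⊆ L) ⊎ ∃ λ j → Edge G x j × All (j ≢_) L
  neighbours-covered-or-escape G x L with covered-or-escapes (adj G x) L
  ... | inj₁ covered        = inj₁ (λ j → covered j ∘ adjacent)
  ... | inj₂ (j , xj , j∉L) = inj₂ (j , edge xj , j∉L)

  neighbours-within : ∀ {G x} (L : List (Fin n)) → (∀ {t} → Edge G x t → All (t ≢_) L → ⊥) → N[ G ∣ x ]⊆ L
  neighbours-within {G} {x} L no-escape with neighbours-covered-or-escape G x L
  ... | inj₁ covered            = covered
  ... | inj₂ (t , xt , t∉L)     = ⊥-elim (no-escape xt t∉L)

  not-neighbour : ∀ {G x y} {L : List (Fin n)} → N[ G ∣ x ]⊆ L → All (y ≢_) L → NonEdge G x y
  not-neighbour N[x] y∉L = ¬edge⇒nonEdge (All¬⇒¬Any y∉L ∘ N[x] _)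

module _ {n : ℕ} {d : Seq n} (G : Graph n) (R : Realizes G d) where

  degree≡count : ∀ x → d x ≡ count (adj G x)
  degree≡count x = trans (sym (R x)) (deg≡count G x)

  degree-≥-length : ∀ {x} {L} → Unique L → All (Edge G x) L → length L ≤ d x
  degree-≥-length {x} uniq xL = subst (_ ≤_) (sym (degree≡count x)) (count-≥-length (adj G x) uniq (All.map adjacent xL))

  degree-≤-length : ∀ {x} (L : List (Fin n)) → N[ G ∣ x ]⊆ L → d x ≤ length L
  degree-≤-length {x} L covered = subst (_≤ _) (sym (degree≡count x)) (count-≤-length (adj G x) L (λ j → covered j ∘ edge))

  neighbour-outside : ∀ {x} (L : List (Fin n)) → length L < d x → ∃ λ j → Edge G x j × All (j ≢_) L
  neighbour-outside {x} L L<dx with escapes (adj G x) L (subst (_ <_) (degree≡count x) L<dx)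
  ... | j , xj , j∉L = j , edge xj , j∉L

  degree≥2 : ∀ {x a b} → Edge G x a → Edge G x b → a ≢ b → 2 ≤ d x
  degree≥2 xa xb a≢b = degree-≥-length ((a≢b ∷ []) ∷ [] ∷ []) (xa ∷ xb ∷ [])

  degree≥3 : ∀ {x a b c} → Edge G x a → Edge G x b → Edge G x c → a ≢ b → a ≢ c → b ≢ c → 3 ≤ d x
  degree≥3 xa xb xc a≢b a≢c b≢c = degree-≥-length ((a≢b ∷ a≢c ∷ []) ∷ (b≢c ∷ []) ∷ [] ∷ []) (xa ∷ xb ∷ xc ∷ [])

  degree≥4 : ∀ {x a b c e} → Edge G x a → Edge G x b → Edge G x c → Edge G x e →
             a ≢ b → a ≢ c → a ≢ e → b ≢ c → b ≢ e → c ≢ e → 4 ≤ d x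
  degree≥4 xa xb xc xe a≢b a≢c a≢e b≢c b≢e c≢e =
    degree-≥-length ((a≢b ∷ a≢c ∷ a≢e ∷ []) ∷ (b≢c ∷ b≢e ∷ []) ∷ (c≢e ∷ []) ∷ [] ∷ []) (xa ∷ xb ∷ xc ∷ xe ∷ [])

  degree≡3 : ∀ {x a b c} → N[ G ∣ x ]⊆ (a ∷ b ∷ c ∷ []) →
             Edge G x a → Edge G x b → Edge G x c → a ≢ b → a ≢ c → b ≢ c → d x ≡ 3
  degree≡3 N[x] xa xb xc a≢b a≢c b≢c = ≤-antisym (degree-≤-length _ N[x]) (degree≥3 xa xb xc a≢b a≢c b≢c)

module _ {n : ℕ} where

  SameEdge : Fin n → Fin n → Fin n → Fin n → Set
  SameEdge x y a b = (x ≡ a × y ≡ b) ⊎ (x ≡ b × y ≡ a)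

  sameEdge? : ∀ x y a b → Dec (SameEdge x y a b)
  sameEdge? x y a b = ((x ≟ a) ×-dec (y ≟ b)) ⊎-dec ((x ≟ b) ×-dec (y ≟ a))

  sameEdge-swap : ∀ {x y a b} → SameEdge x y a b → SameEdge y x a b
  sameEdge-swap (inj₁ (x≡a , y≡b)) = inj₂ (y≡b , x≡a)
  sameEdge-swap (inj₂ (x≡b , y≡a)) = inj₁ (y≡a , x≡b)

  x∉ab : ∀ {x y a b} → x ≢ a → x ≢ b → ¬ SameEdge x y a b
  x∉ab x≢a x≢b (inj₁ (x≡a , _)) = x≢a x≡a
  x∉ab x≢a x≢b (inj₂ (x≡b , _)) = x≢b x≡b

  y∉ab : ∀ {x y a b} → y ≢ a → y ≢ b → ¬ SameEdge x y a b
  y∉ab y≢a y≢b = x∉ab y≢a y≢b ∘ sameEdge-swap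

  a∉xy : ∀ {x y a b} → x ≢ a → y ≢ a → ¬ SameEdge x y a b
  a∉xy x≢a y≢a (inj₁ (x≡a , _)) = x≢a x≡a
  a∉xy x≢a y≢a (inj₂ (_ , y≡a)) = y≢a y≡a

  b∉xy : ∀ {x y a b} → x ≢ b → y ≢ b → ¬ SameEdge x y a b
  b∉xy x≢b y≢b (inj₁ (_ , y≡b)) = y≢b y≡b
  b∉xy x≢b y≢b (inj₂ (x≡b , _)) = x≢b x≡b

  -- The 2-switch: delete the edges ab and ce, insert ac and be.
  switch : Graph n → Fin n → Fin n → Fin n → Fin n → Graph n
  switch G a b c e = record { adj = adj′ ; sym = adj′-sym ; irrefl = adj′-irrefl }
    where
    is : Fin n → Fin n → Fin n → Fin n → Bool
    is x y u v = does (sameEdge? x y u v)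
    adj′ : Fin n → Fin n → Bool
    adj′ x y = if does (x ≟ y) then false
               else if is x y a b ∨ is x y c e then false
               else if is x y a c ∨ is x y b e then true
               else adj G x y
    is-sym : ∀ x y u v → is x y u v ≡ is y x u v
    is-sym x y u v = does-≡ (map′ sameEdge-swap sameEdge-swap (sameEdge? x y u v)) (sameEdge? y x u v)
    adj′-sym : ∀ x y → adj′ x y ≡ adj′ y x
    adj′-sym x y rewrite does-≡ (map′ sym sym (x ≟ y)) (y ≟ x)
                       | is-sym x y a b | is-sym x y c e | is-sym x y a c | is-sym x y b e
                       | Graph.sym G x y = refl
    adj′-irrefl : ∀ x → adj′ x x ≡ false
    adj′-irrefl x rewrite dec-true (x ≟ x) refl = refl

  module _ (G : Graph n) (a b c e : Fin n) where
    private
      G′ = switch G a b c e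

    switch-keeps-edge : ∀ {x y} → Edge G x y → ¬ SameEdge x y a b → ¬ SameEdge x y c e → Edge G′ x y
    switch-keeps-edge {x} {y} xy ¬ab ¬ce = edge kept
      where
      kept : adj G′ x y ≡ true
      kept rewrite dec-false (x ≟ y) (edge⇒≢ xy) | dec-false (sameEdge? x y a b) ¬ab | dec-false (sameEdge? x y c e) ¬ce
                 | adjacent xy with does (sameEdge? x y a c) ∨ does (sameEdge? x y b e)
      ... | true  = refl
      ... | false = refl

    switch-keeps-nonEdge : ∀ {x y} → NonEdge G x y → ¬ SameEdge x y a c → ¬ SameEdge x y b e → NonEdge G′ x y
    switch-keeps-nonEdge {x} {y} x≁y ¬ac ¬be = nonEdge kept
      where
      kept : adj G′ x y ≡ false
      kept rewrite dec-false (sameEdge? x y a c) ¬ac | dec-false (sameEdge? x y b e) ¬be | nonadjacent x≁y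
        with does (x ≟ y) | does (sameEdge? x y a b) ∨ does (sameEdge? x y c e)
      ... | true  | _     = refl
      ... | false | true  = refl
      ... | false | false = refl

    switch-keeps-edge-from : ∀ {x y} → All (x ≢_) (a ∷ b ∷ c ∷ e ∷ []) → Edge G x y → Edge G′ x y
    switch-keeps-edge-from (x≢a ∷ x≢b ∷ x≢c ∷ x≢e ∷ []) xy = switch-keeps-edge xy (x∉ab x≢a x≢b) (x∉ab x≢c x≢e)

    switch-keeps-nonEdge-from : ∀ {x y} → All (x ≢_) (a ∷ b ∷ c ∷ e ∷ []) → NonEdge G x y → NonEdge G′ x y
    switch-keeps-nonEdge-from (x≢a ∷ x≢b ∷ x≢c ∷ x≢e ∷ []) x≁y = switch-keeps-nonEdge x≁y (x∉ab x≢a x≢c) (x∉ab x≢b x≢e)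

    switch-unchanged : ∀ {x y} → ¬ SameEdge x y a b → ¬ SameEdge x y c e → ¬ SameEdge x y a c → ¬ SameEdge x y b e →
                       adj G′ x y ≡ adj G x y
    switch-unchanged {x} {y} ¬ab ¬ce ¬ac ¬be with x ≟ y
    ... | yes refl = sym (irrefl G x)
    ... | no _ rewrite dec-false (sameEdge? x y a b) ¬ab | dec-false (sameEdge? x y c e) ¬ce
                     | dec-false (sameEdge? x y a c) ¬ac | dec-false (sameEdge? x y b e) ¬be = refl

    switch-removes : ∀ {x y} → SameEdge x y a b ⊎ SameEdge x y c e → NonEdge G′ x y
    switch-removes {x} {y} = nonEdge ∘ removed′
      where
      removed′ : SameEdge x y a b ⊎ SameEdge x y c e → adj G′ x y ≡ false
      removed′ _ with does (x ≟ y)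
      removed′ _           | true  = refl
      removed′ (inj₁ ab)   | false rewrite dec-true (sameEdge? x y a b) ab = refl
      removed′ (inj₂ ce)   | false rewrite dec-true (sameEdge? x y c e) ce with does (sameEdge? x y a b)
      ... | true  = refl
      ... | false = refl

    switch-adds : ∀ {x y} → x ≢ y → ¬ SameEdge x y a b → ¬ SameEdge x y c e →
                  SameEdge x y a c ⊎ SameEdge x y b e → Edge G′ x y
    switch-adds {x} {y} x≢y ¬ab ¬ce = edge ∘ added′
      where
      added′ : SameEdge x y a c ⊎ SameEdge x y b e → adj G′ x y ≡ true
      added′ added rewrite dec-false (x ≟ y) x≢y | dec-false (sameEdge? x y a b) ¬ab | dec-false (sameEdge? x y c e) ¬ce
        with added
      ... | inj₁ ac rewrite dec-true (sameEdge? x y a c) ac = refl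
      ... | inj₂ be rewrite dec-true (sameEdge? x y b e) be with does (sameEdge? x y a c)
      ...   | true  = refl
      ...   | false = refl

  record Switchable (G : Graph n) (a b c e : Fin n) : Set where
    constructor switchable
    field
      ab  : Edge G a b
      ce  : Edge G c e
      a≁c : NonEdge G a c
      b≁e : NonEdge G b e
      a≢c : a ≢ c
      b≢e : b ≢ e

    a≢b : a ≢ b
    a≢b = edge⇒≢ ab

    c≢e : c ≢ e
    c≢e = edge⇒≢ ce

    a≢e : a ≢ e
    a≢e refl = edge-nonEdge-⊥ (edge-sym ab) b≁e

    b≢c : b ≢ c
    b≢c refl = edge-nonEdge-⊥ ab a≁c

  module _ {G : Graph n} {a b c e : Fin n} (S : Switchable G a b c e) where
    open Switchable S

    switch-adds-ac : Edge (switch G a b c e) a c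
    switch-adds-ac = switch-adds G a b c e a≢c (y∉ab (≢-sym a≢c) (≢-sym b≢c)) (x∉ab a≢c a≢e) (inj₁ (inj₁ (refl , refl)))

    switch-adds-be : Edge (switch G a b c e) b e
    switch-adds-be = switch-adds G a b c e b≢e (a∉xy (≢-sym a≢b) (≢-sym a≢e)) (x∉ab b≢c b≢e) (inj₂ (inj₁ (refl , refl)))

    -- Only a, b, c and e change their neighbourhoods, and each of them trades one neighbour for another.
    switch-realizes : ∀ {d : Seq n} → Realizes G d → Realizes (switch G a b c e) d
    switch-realizes R x = trans (deg≡count G′ x) (trans (count-preserved x) (trans (sym (deg≡count G x)) (R x)))
      where
      G′ = switch G a b c e
      unchanged = switch-unchanged G a b c e
      removes = switch-removes G a b c e
      trades : ∀ {x p q} → Edge G x p → NonEdge G x q → NonEdge G′ x p → Edge G′ x q →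
               (∀ j → j ≢ p → j ≢ q → adj G′ x j ≡ adj G x j) → count (adj G′ x) ≡ count (adj G x)
      trades xp x≁q x≁′p x∼′q =
        count-swap _ _ (edge-nonEdge⇒≢ xp x≁q) (adjacent xp) (nonadjacent x≁q) (nonadjacent x≁′p) (adjacent x∼′q)
      count-preserved : ∀ x → count (adj G′ x) ≡ count (adj G x)
      count-preserved x = by-cases x (x ≟ a) (x ≟ b) (x ≟ c) (x ≟ e)
        where
        by-cases : ∀ x → Dec (x ≡ a) → Dec (x ≡ b) → Dec (x ≡ c) → Dec (x ≡ e) → count (adj G′ x) ≡ count (adj G x)
        by-cases x (yes refl) _ _ _ =
          trades ab a≁c (removes (inj₁ (inj₁ (refl , refl)))) switch-adds-ac
            (λ j j≢b j≢c → unchanged (b∉xy a≢b j≢b) (x∉ab a≢c a≢e) (b∉xy a≢c j≢c) (x∉ab a≢b a≢e))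
        by-cases x (no _) (yes refl) _ _ =
          trades (edge-sym ab) b≁e (removes (inj₁ (inj₂ (refl , refl)))) switch-adds-be
            (λ j j≢a j≢e → unchanged (a∉xy (≢-sym a≢b) j≢a) (x∉ab b≢c b≢e) (x∉ab (≢-sym a≢b) b≢c) (b∉xy b≢e j≢e))
        by-cases x (no _) (no _) (yes refl) _ =
          trades ce (nonEdge-sym a≁c) (removes (inj₂ (inj₁ (refl , refl)))) (edge-sym switch-adds-ac)
            (λ j j≢e j≢a → unchanged (x∉ab (≢-sym a≢c) (≢-sym b≢c)) (b∉xy c≢e j≢e)
                                     (a∉xy (≢-sym a≢c) j≢a) (x∉ab (≢-sym b≢c) c≢e))
        by-cases x (no _) (no _) (no _) (yes refl) =
          trades (edge-sym ce) (nonEdge-sym b≁e) (removes (inj₂ (inj₂ (refl , refl)))) (edge-sym switch-adds-be)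
            (λ j j≢c j≢b → unchanged (x∉ab (≢-sym a≢e) (≢-sym b≢e)) (a∉xy (≢-sym c≢e) j≢c)
                                     (x∉ab (≢-sym a≢e) (≢-sym c≢e)) (a∉xy (≢-sym b≢e) j≢b))
        by-cases x (no x≢a) (no x≢b) (no x≢c) (no x≢e) =
          count-cong {r = adj G′ x} {s = adj G x}
            (λ j → unchanged (x∉ab x≢a x≢b) (x∉ab x≢c x≢e) (x∉ab x≢a x≢c) (x∉ab x≢b x≢e))

module _ {n : ℕ} where

  record Diamond (G : Graph n) (p q r s : Fin n) : Set where
    constructor diamond
    field
      pq : Edge G p q
      pr : Edge G p r
      ps : Edge G p s
      qr : Edge G q r
      qs : Edge G q s
      r≢s : r ≢ s

  -- K₅ − Y₄ is a diamond with a pendant edge rx at the tip r; (p, x, s, r, q) are the vertices 0, …, 4 of K5-Y4.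
  record PendantDiamond (G : Graph n) : Set where
    constructor pendantDiamond
    field
      {p q r s x} : Fin n
      isDiamond : Diamond G p q r s
      rx : Edge G r x
      x≢p : x ≢ p
      x≢q : x ≢ q
      x≢s : x ≢ s

  pendantDiamond⇒copy : ∀ {G} → PendantDiamond G → ContainsSubgraph G K5-Y4
  pendantDiamond⇒copy {G} (pendantDiamond {p} {q} {r} {s} {x} (diamond pq pr ps qr qs r≢s) rx x≢p x≢q x≢s) =
    lookup vertices , lookup-injective distinct _ _ , λ a b → adjacent ∘ edges a b
    where
    vertices : Vec (Fin n) 5
    vertices = p ∷ x ∷ s ∷ r ∷ q ∷ []
    x≢r = ≢-sym (edge⇒≢ rx)
    distinct : UniqueV vertices
    distinct = (≢-sym x≢p ∷ edge⇒≢ ps ∷ edge⇒≢ pr ∷ edge⇒≢ pq ∷ [])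
             ∷ (x≢s ∷ x≢r ∷ x≢q ∷ [])
             ∷ (≢-sym r≢s ∷ ≢-sym (edge⇒≢ qs) ∷ [])
             ∷ (≢-sym (edge⇒≢ qr) ∷ [])
             ∷ [] ∷ []
    edges : ∀ a b → (a , b) ∈ K5-Y4 → Edge G (lookup vertices a) (lookup vertices b)
    edges _ _ (here refl)                                         = ps
    edges _ _ (there (here refl))                                 = pr
    edges _ _ (there (there (here refl)))                         = pq
    edges _ _ (there (there (there (here refl))))                 = edge-sym rx
    edges _ _ (there (there (there (there (here refl)))))         = edge-sym qs
    edges _ _ (there (there (there (there (there (here refl)))))) = edge-sym qr

  copy⇒pendantDiamond : ∀ {G} → ContainsSubgraph G K5-Y4 → PendantDiamond G
  copy⇒pendantDiamond {G} (f , f-injective , edges) =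
    pendantDiamond
      (diamond (edge-of (there (there (here refl))))
               (edge-of (there (here refl)))
               (edge-of (here refl))
               (edge-sym (edge-of (there (there (there (there (there (here refl))))))))
               (edge-sym (edge-of (there (there (there (there (here refl)))))))
               (distinct (λ ())))
      (edge-sym (edge-of (there (there (there (here refl))))))
      (distinct (λ ())) (distinct (λ ())) (distinct (λ ()))
    where
    distinct : ∀ {i j} → i ≢ j → f i ≢ f j
    distinct i≢j = i≢j ∘ f-injective
    edge-of : ∀ {a b} → (a , b) ∈ K5-Y4 → Edge G (f a) (f b)
    edge-of = edge ∘ edges _ _

member-outside : ∀ {n} {V : List (Fin n)} (L : List (Fin n)) → Unique V → length L < length V →
                 ∃ λ v → v ∈ V × All (v ≢_) L
member-outside {V = V} L uniq L<V
  with escapes (λ j → does (Any.any? (j ≟_) V)) L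
                (<-≤-trans L<V (count-≥-length _ uniq (All.tabulate (λ {v} → dec-true (Any.any? (v ≟_) V)))))
... | v , v∈?V , v∉L with Any.any? (v ≟_) V
...   | yes v∈V = v , v∈V , v∉L
...   | no _ with () ← v∈?V

initial-segment : ∀ {n k} → k < n → List (Fin n)
initial-segment {k = k} k<n = tabulate {n = k} (λ i → inject≤ i (<⇒≤ k<n))

∉initial-segment⇒≥ : ∀ {n k} (k<n : k < n) {v : Fin n} → All (v ≢_) (initial-segment k<n) → k ≤ toℕ v
∉initial-segment⇒≥ {k = k} k<n {v} v∉ with k ≤? toℕ v
... | yes k≤v = k≤v
... | no  k≰v = ⊥-elim (All¬⇒¬Any v∉ (subst (_∈ initial-segment k<n) v≡ (∈-tabulate⁺ (fromℕ< v<k))))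
  where
  v<k = ≰⇒> k≰v
  v≡ : inject≤ (fromℕ< v<k) (<⇒≤ k<n) ≡ v
  v≡ = toℕ-injective (trans (toℕ-inject≤ (fromℕ< v<k) (<⇒≤ k<n)) (toℕ-fromℕ< v<k))

nonIncreasing-≥ : ∀ {n} {d : Seq n} → NonIncreasing d → ∀ {k m} (k<n : k < n) {V : List (Fin n)} →
                  Unique V → k < length V → All (λ v → m ≤ d v) V → m ≤ d (fromℕ< k<n)
nonIncreasing-≥ {d = d} nonIncreasing {k} k<n uniq k<V large
  with member-outside (initial-segment k<n) uniq (subst (_< _) (sym (length-tabulate _)) k<V)
... | v , v∈V , v∉ = ≤-trans (All.lookup large v∈V) (nonIncreasing _ v fromℕ<≤v)
  where
  fromℕ<≤v = subst (_≤ toℕ v) (sym (toℕ-fromℕ< k<n)) (∉initial-segment⇒≥ k<n v∉)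

module _ {n : ℕ} {d : Seq n} {G : Graph n} (R : Realizes G d) (P : PendantDiamond G) where
  open PendantDiamond P
  open Diamond isDiamond

  pendantDiamond-unique : Unique (p ∷ q ∷ r ∷ s ∷ x ∷ [])
  pendantDiamond-unique =
      (edge⇒≢ pq ∷ edge⇒≢ pr ∷ edge⇒≢ ps ∷ ≢-sym x≢p ∷ [])
    ∷ (edge⇒≢ qr ∷ edge⇒≢ qs ∷ ≢-sym x≢q ∷ [])
    ∷ (r≢s ∷ edge⇒≢ rx ∷ [])
    ∷ (≢-sym x≢s ∷ [])
    ∷ [] ∷ []

  pendantDiamond-degrees≥3 : All (λ v → 3 ≤ d v) (p ∷ q ∷ r ∷ [])
  pendantDiamond-degrees≥3 =
      degree≥3 G R pq pr ps (edge⇒≢ qr) (edge⇒≢ qs) r≢s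
    ∷ degree≥3 G R (edge-sym pq) qr qs (edge⇒≢ pr) (edge⇒≢ ps) r≢s
    ∷ degree≥3 G R (edge-sym pr) (edge-sym qr) rx (edge⇒≢ pq) (≢-sym x≢p) (≢-sym x≢q)
    ∷ []

  pendantDiamond-degrees≥2 : All (λ v → 2 ≤ d v) (p ∷ q ∷ r ∷ s ∷ [])
  pendantDiamond-degrees≥2 =
    ++⁺ (All.map (≤-trans (s≤s (s≤s z≤n))) pendantDiamond-degrees≥3)
        (degree≥2 G R (edge-sym ps) (edge-sym qs) (edge⇒≢ pq) ∷ [])

  -- In a 3-regular realization p, q and r are saturated by the copy, so a sixth vertex has a neighbour outside
  -- all six vertices found so far.
  pendantDiamond-¬3⁶ : ¬ (n ≡ 6 × (∀ i → d i ≡ 3))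
  pendantDiamond-¬3⁶ (refl , cubic) with vertex-outside (p ∷ q ∷ r ∷ s ∷ x ∷ []) ≤-refl
  ... | w , w∉@(w≢p ∷ w≢q ∷ w≢r ∷ w≢s ∷ w≢x ∷ []) with neighbour-outside G R (s ∷ x ∷ []) (≤-reflexive (sym (cubic w)))
  ...   | j , wj , j≢s ∷ j≢x ∷ [] = <⇒≱ ≤-refl (unique⇒length≤ seven-vertices)
    where
    not-saturated : ∀ {v} → 4 ≤ d v → ⊥
    not-saturated {v} 4≤dv = <⇒≱ 4≤dv (≤-reflexive (cubic v))
    jw : ∀ {v} → j ≡ v → Edge G v w
    jw refl = edge-sym wj
    j≢p : j ≢ p
    j≢p j≡p = not-saturated (degree≥4 G R pq pr ps (jw j≡p)
                                       (edge⇒≢ qr) (edge⇒≢ qs) (≢-sym w≢q) r≢s (≢-sym w≢r) (≢-sym w≢s))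
    j≢q : j ≢ q
    j≢q j≡q = not-saturated (degree≥4 G R (edge-sym pq) qr qs (jw j≡q)
                                       (edge⇒≢ pr) (edge⇒≢ ps) (≢-sym w≢p) r≢s (≢-sym w≢r) (≢-sym w≢s))
    j≢r : j ≢ r
    j≢r j≡r = not-saturated (degree≥4 G R (edge-sym pr) (edge-sym qr) rx (jw j≡r)
                                       (edge⇒≢ pq) (≢-sym x≢p) (≢-sym w≢p) (≢-sym x≢q) (≢-sym w≢q) (≢-sym w≢x))
    seven-vertices : Unique (j ∷ w ∷ p ∷ q ∷ r ∷ s ∷ x ∷ [])
    seven-vertices = (≢-sym (edge⇒≢ wj) ∷ j≢p ∷ j≢q ∷ j≢r ∷ j≢s ∷ j≢x ∷ []) ∷ w∉ ∷ pendantDiamond-unique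

pendantDiamond⇒conditions : ∀ {m} {d : Seq (5 + m)} {G} → NonIncreasing d → Realizes G d → PendantDiamond G →
                            3 ≤ d (suc (suc zero)) × 2 ≤ d (suc (suc (suc zero))) × ¬ (5 + m ≡ 6 × (∀ i → d i ≡ 3))
pendantDiamond⇒conditions nonIncreasing R P =
    nonIncreasing-≥ nonIncreasing (s≤s (s≤s (s≤s z≤n))) (take⁺ 3 (pendantDiamond-unique R P)) ≤-refl
                    (pendantDiamond-degrees≥3 R P)
  , nonIncreasing-≥ nonIncreasing (s≤s (s≤s (s≤s (s≤s z≤n)))) (take⁺ 4 (pendantDiamond-unique R P)) ≤-refl
                    (pendantDiamond-degrees≥2 R P)
  , pendantDiamond-¬3⁶ R P

module Sufficiency {n : ℕ} (d : Seq n) (positive : ∀ i → 1 ≤ d i) (5≤n : 5 ≤ n)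
                   (not-3⁶ : ¬ (n ≡ 6 × (∀ i → d i ≡ 3))) where

  Realizable : (Graph n → Set) → Set
  Realizable P = Σ (Graph n) λ G → Realizes G d × P G

  -- The K₄ is a whole component, so an edge uy lies outside it, and trading rs, uy for ru, sy leaves the pendant ru.
  isolated-K4⇒pendantDiamond : ∀ G → Realizes G d → ∀ {p q r s} → Diamond G p q r s → Edge G r s →
                               N[ G ∣ p ]⊆ (q ∷ r ∷ s ∷ []) → N[ G ∣ q ]⊆ (p ∷ r ∷ s ∷ []) →
                               N[ G ∣ r ]⊆ (p ∷ q ∷ s ∷ []) → N[ G ∣ s ]⊆ (p ∷ q ∷ r ∷ []) → Realizable PendantDiamond
  isolated-K4⇒pendantDiamond G R {p} {q} {r} {s} (diamond pq pr ps qr qs r≢s) rs N[p] N[q] N[r] N[s]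
    with vertex-outside (p ∷ q ∷ r ∷ s ∷ []) 5≤n
  ... | u , u≢p ∷ u≢q ∷ u≢r ∷ u≢s ∷ [] with neighbour-outside G R [] (positive u)
  ...   | y , uy , [] = G′ , switch-realizes S R , pendantDiamond (diamond (kept-p pq) (kept-p pr) (kept-p ps) (kept-q qr) (kept-q qs) r≢s)
                         (switch-adds-ac S) u≢p u≢q u≢s
    where
    y∉K4 : ∀ {v L} → N[ G ∣ v ]⊆ L → All (u ≢_) L → y ≢ v
    y∉K4 N[v] u∉L refl = edge-nonEdge-⊥ (edge-sym uy) (not-neighbour N[v] u∉L)
    y≢p = y∉K4 N[p] (u≢q ∷ u≢r ∷ u≢s ∷ [])
    y≢q = y∉K4 N[q] (u≢p ∷ u≢r ∷ u≢s ∷ [])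
    y≢r = y∉K4 N[r] (u≢p ∷ u≢q ∷ u≢s ∷ [])
    y≢s = y∉K4 N[s] (u≢p ∷ u≢q ∷ u≢r ∷ [])
    S : Switchable G r s u y
    S = switchable rs uy (not-neighbour N[r] (u≢p ∷ u≢q ∷ u≢s ∷ []))
                         (not-neighbour N[s] (y≢p ∷ y≢q ∷ y≢r ∷ []))
                         (≢-sym u≢r) (≢-sym y≢s)
    G′ = switch G r s u y
    kept-p : ∀ {b} → Edge G p b → Edge G′ p b
    kept-p = switch-keeps-edge-from G r s u y (edge⇒≢ pr ∷ edge⇒≢ ps ∷ ≢-sym u≢p ∷ ≢-sym y≢p ∷ [])
    kept-q : ∀ {b} → Edge G q b → Edge G′ q b
    kept-q = switch-keeps-edge-from G r s u y (edge⇒≢ qr ∷ edge⇒≢ qs ∷ ≢-sym u≢q ∷ ≢-sym y≢q ∷ [])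

  K4⇒pendantDiamond : ∀ G → Realizes G d → ∀ {p q r s} → Diamond G p q r s → Edge G r s → Realizable PendantDiamond
  K4⇒pendantDiamond G R {p} {q} {r} {s} D@(diamond pq pr ps qr qs r≢s) rs
    with neighbours-covered-or-escape G p (q ∷ r ∷ s ∷ [])
       | neighbours-covered-or-escape G q (p ∷ r ∷ s ∷ [])
       | neighbours-covered-or-escape G r (p ∷ q ∷ s ∷ [])
       | neighbours-covered-or-escape G s (p ∷ q ∷ r ∷ [])
  ... | inj₂ (x , px , x≢q ∷ x≢r ∷ x≢s ∷ []) | _ | _ | _ =
        G , R , pendantDiamond (diamond qr (edge-sym pq) qs (edge-sym pr) rs (edge⇒≢ ps)) px x≢q x≢r x≢s
  ... | _ | inj₂ (x , qx , x≢p ∷ x≢r ∷ x≢s ∷ []) | _ | _ =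
        G , R , pendantDiamond (diamond pr pq ps (edge-sym qr) rs (edge⇒≢ qs)) qx x≢p x≢r x≢s
  ... | _ | _ | inj₂ (x , rx , x≢p ∷ x≢q ∷ x≢s ∷ []) | _ =
        G , R , pendantDiamond D rx x≢p x≢q x≢s
  ... | _ | _ | _ | inj₂ (x , sx , x≢p ∷ x≢q ∷ x≢r ∷ []) =
        G , R , pendantDiamond (diamond pq ps pr qs qr (≢-sym r≢s)) sx x≢p x≢q x≢r
  ... | inj₁ N[p] | inj₁ N[q] | inj₁ N[r] | inj₁ N[s] = isolated-K4⇒pendantDiamond G R D rs N[p] N[q] N[r] N[s]

  diamond⇒pendantDiamond : ∀ G → Realizes G d → ∀ {p q r s} → Diamond G p q r s → 3 ≤ d r → Realizable PendantDiamond
  diamond⇒pendantDiamond G R {p} {q} {r} {s} D r3 with edge-or-nonEdge G r s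
  ... | inj₁ rs  = K4⇒pendantDiamond G R D rs
  ... | inj₂ r≁s with neighbour-outside G R (p ∷ q ∷ []) r3
  ...   | x , rx , x≢p ∷ x≢q ∷ [] = G , R , pendantDiamond D rx x≢p x≢q (edge-nonEdge⇒≢ rx r≁s)

  -- Trading jb, az for ja, bz makes a a second common neighbour of i and j.
  triangle-switch⇒pendantDiamond : ∀ G → Realizes G d → ∀ {i j k a b z} → Edge G i j → Edge G i k → Edge G j k → 3 ≤ d k →
                                   Edge G i a → a ≢ j → a ≢ k → NonEdge G a j → Edge G j b → b ≢ i → b ≢ k →
                                   Edge G a z → z ≢ i → z ≢ b → NonEdge G z b → Realizable PendantDiamond
  triangle-switch⇒pendantDiamond G R {i} {j} {k} {a} {b} {z} ij ik jk k3 ia a≢j a≢k a≁j jb b≢i b≢k az z≢i z≢b z≁b =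
    diamond⇒pendantDiamond G′ (switch-realizes S R)
      (diamond (kept-i ij) (kept-i ik) (kept-i ia) jk′ (switch-adds-ac S) (≢-sym a≢k)) k3
    where
    S : Switchable G j b a z
    S = switchable jb az (nonEdge-sym a≁j) (nonEdge-sym z≁b) (≢-sym a≢j) (≢-sym z≢b)
    G′ = switch G j b a z
    kept-i : ∀ {v} → Edge G i v → Edge G′ i v
    kept-i = switch-keeps-edge-from G j b a z (edge⇒≢ ij ∷ ≢-sym b≢i ∷ edge⇒≢ ia ∷ ≢-sym z≢i ∷ [])
    jk′ : Edge G′ j k
    jk′ = switch-keeps-edge G j b a z jk (b∉xy (edge⇒≢ jb) (≢-sym b≢k)) (x∉ab (≢-sym a≢j) (≢-sym (edge-nonEdge⇒≢ az a≁j)))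

  -- The switch (ix)(ty) makes t a neighbour of i; if t is not yet adjacent to j or k, the switch (kw)(tx) then
  -- makes it adjacent to k.
  triangle-path⇒pendantDiamond : ∀ G → Realizes G d → ∀ {i j k x y w t} →
                                 Edge G i j → Edge G i k → Edge G j k → 3 ≤ d j → 3 ≤ d k →
                                 Edge G i x → x ≢ j → x ≢ k → NonEdge G x j → NonEdge G x k → NonEdge G x y → NonEdge G x w →
                                 Edge G j y → y ≢ k → NonEdge G y k → Edge G k w → w ≢ i → w ≢ j →
                                 Edge G x t → Edge G t y → t ≢ i → NonEdge G t i → Realizable PendantDiamond
  triangle-path⇒pendantDiamond G R {i} {j} {k} {x} {y} {w} {t}
                               ij ik jk j3 k3 ix x≢j x≢k x≁j x≁k x≁y x≁w jy y≢k y≁k kw w≢i w≢j xt ty t≢i t≁i =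
    by-cases (edge-or-nonEdge G t j) (edge-or-nonEdge G t k)
    where
    t≢j = edge-nonEdge⇒≢ xt x≁j
    t≢k = edge-nonEdge⇒≢ xt x≁k
    t≢y = edge-nonEdge⇒≢ xt x≁y
    x≢y = ≢-sym (edge-nonEdge⇒≢ jy (nonEdge-sym x≁j))
    S₁ : Switchable G i x t y
    S₁ = switchable ix ty (nonEdge-sym t≁i) x≁y (≢-sym t≢i) x≢y
    G₁ = switch G i x t y
    R₁ = switch-realizes S₁ R
    j∉₁ = ≢-sym (edge⇒≢ ij) ∷ ≢-sym x≢j ∷ ≢-sym t≢j ∷ edge⇒≢ jy ∷ []
    k∉₁ = ≢-sym (edge⇒≢ ik) ∷ ≢-sym x≢k ∷ ≢-sym t≢k ∷ ≢-sym y≢k ∷ []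
    ij₁ : Edge G₁ i j
    ij₁ = edge-sym (switch-keeps-edge-from G i x t y j∉₁ (edge-sym ij))
    ik₁ : Edge G₁ i k
    ik₁ = edge-sym (switch-keeps-edge-from G i x t y k∉₁ (edge-sym ik))
    jk₁ : Edge G₁ j k
    jk₁ = switch-keeps-edge-from G i x t y j∉₁ jk
    it₁ : Edge G₁ i t
    it₁ = switch-adds-ac S₁

    by-cases : Edge G t j ⊎ NonEdge G t j → Edge G t k ⊎ NonEdge G t k → Realizable PendantDiamond
    by-cases (inj₁ tj) _ =
      diamond⇒pendantDiamond G₁ R₁ (diamond ij₁ ik₁ it₁ jk₁ (switch-keeps-edge-from G i x t y j∉₁ (edge-sym tj)) (≢-sym t≢k)) k3
    by-cases _ (inj₁ tk) =
      diamond⇒pendantDiamond G₁ R₁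
        (diamond ik₁ ij₁ it₁ (edge-sym jk₁) (switch-keeps-edge-from G i x t y k∉₁ (edge-sym tk)) (≢-sym t≢j)) j3
    by-cases (inj₂ t≁j) (inj₂ t≁k) =
      diamond⇒pendantDiamond G₂ (switch-realizes S₂ R₁)
        (diamond (kept₂ i∉₂ ik₁) (kept₂ i∉₂ ij₁) (kept₂ i∉₂ it₁) (edge-sym (kept₂ j∉₂ jk₁)) (switch-adds-ac S₂) (≢-sym t≢j))
        j3
      where
      w≢x = edge-nonEdge⇒≢ kw (nonEdge-sym x≁k)
      w≢t = edge-nonEdge⇒≢ kw (nonEdge-sym t≁k)
      w≢y = edge-nonEdge⇒≢ kw (nonEdge-sym y≁k)
      S₂ : Switchable G₁ k w t x
      S₂ = switchable (switch-keeps-edge-from G i x t y k∉₁ kw)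
                      (switch-keeps-edge G i x t y (edge-sym xt) (x∉ab t≢i (edge⇒≢ (edge-sym xt))) (b∉xy t≢y x≢y))
                      (switch-keeps-nonEdge-from G i x t y k∉₁ (nonEdge-sym t≁k))
                      (switch-keeps-nonEdge-from G i x t y (w≢i ∷ w≢x ∷ w≢t ∷ w≢y ∷ []) (nonEdge-sym x≁w))
                      (≢-sym t≢k) w≢x
      G₂ = switch G₁ k w t x
      kept₂ : ∀ {v b} → All (v ≢_) (k ∷ w ∷ t ∷ x ∷ []) → Edge G₁ v b → Edge G₂ v b
      kept₂ = switch-keeps-edge-from G₁ k w t x
      i∉₂ = edge⇒≢ ik ∷ ≢-sym w≢i ∷ ≢-sym t≢i ∷ edge⇒≢ ix ∷ []
      j∉₂ = edge⇒≢ jk ∷ ≢-sym w≢j ∷ ≢-sym t≢j ∷ ≢-sym x≢j ∷ []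

  module TriangleWithoutCommonNeighbours
    (G : Graph n) (R : Realizes G d) {p q r : Fin n} (pq : Edge G p q) (pr : Edge G p r) (qr : Edge G q r)
    (p3 : 3 ≤ d p) (q3 : 3 ≤ d q) (r3 : 3 ≤ d r) {v : Fin n} (v≢p : v ≢ p) (v≢q : v ≢ q) (v≢r : v ≢ r) (v2 : 2 ≤ d v)
    (lonely-pq : ∀ {a} → All (a ≢_) (p ∷ q ∷ r ∷ []) → Edge G a p → Edge G a q → ⊥)
    (lonely-pr : ∀ {a} → All (a ≢_) (p ∷ q ∷ r ∷ []) → Edge G a p → Edge G a r → ⊥)
    (lonely-qr : ∀ {a} → All (a ≢_) (p ∷ q ∷ r ∷ []) → Edge G a q → Edge G a r → ⊥) where

    Outside : Fin n → Set
    Outside a = All (a ≢_) (p ∷ q ∷ r ∷ [])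

    outside? : ∀ a → Dec (Outside a)
    outside? a = avoids? a (p ∷ q ∷ r ∷ [])

    -- Closed i j fails exactly when triangle-switch⇒pendantDiamond applies to the ordered pair i, j.
    Closed : Fin n → Fin n → Set
    Closed i j = ∀ {a b z} → Edge G i a → Outside a → Edge G j b → Outside b → Edge G a z → z ≢ i → z ≢ b → Edge G z b

    closed-or-pendantDiamond : ∀ {i j k} → Edge G i j → Edge G i k → Edge G j k → 3 ≤ d k →
                               (∀ {a} → Outside a → a ≢ i × a ≢ j × a ≢ k) → (∀ {a} → Outside a → Edge G i a → NonEdge G a j) →
                               Realizable PendantDiamond ⊎ Closed i j
    closed-or-pendantDiamond {i} {j} {k} ij ik jk k3 roles lonely
      with any? (λ a → any? (λ b → any? (λ z →
             edge? G i a ×-dec outside? a ×-dec edge? G j b ×-dec outside? b ×-dec edge? G a z ×-dec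
             ¬? (z ≟ i) ×-dec ¬? (z ≟ b) ×-dec ¬? (edge? G z b))))
    ... | yes (a , b , z , ia , oa , jb , ob , az , z≢i , z≢b , ¬zb) with roles oa | roles ob
    ...   | _ , a≢j , a≢k | b≢i , _ , b≢k =
            inj₁ (triangle-switch⇒pendantDiamond G R ij ik jk k3 ia a≢j a≢k (lonely oa ia) jb b≢i b≢k
                                                 az z≢i z≢b (¬edge⇒nonEdge ¬zb))
    closed-or-pendantDiamond {i} {j} {k} ij ik jk k3 roles lonely | no none = inj₂ closed
      where
      closed : Closed i j
      closed {a} {b} {z} ia oa jb ob az z≢i z≢b with edge? G z b
      ... | yes zb = zb
      ... | no ¬zb = ⊥-elim (none (a , b , z , ia , oa , jb , ob , az , z≢i , z≢b , ¬zb))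

    -- If x ∼ y then x y w is a second triangle, which either
    -- carries a diamond with tip w or forms a prism with p q r. Otherwise a further neighbour of x or y yields a
    -- path for triangle-path⇒pendantDiamond, and if x and y are leaves, v is switched onto p and q.
    module PrivateNeighbours
      (closed-pq : Closed p q) (closed-qp : Closed q p) (closed-pr : Closed p r)
      (closed-rp : Closed r p) (closed-qr : Closed q r) (closed-rq : Closed r q)
      {x y w : Fin n} (px : Edge G p x) (x≢q : x ≢ q) (x≢r : x ≢ r) (qy : Edge G q y) (y≢p : y ≢ p) (y≢r : y ≢ r)
      (rw : Edge G r w) (w≢p : w ≢ p) (w≢q : w ≢ q) where

      x≢p = ≢-sym (edge⇒≢ px)
      y≢q = ≢-sym (edge⇒≢ qy)
      w≢r = ≢-sym (edge⇒≢ rw)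
      x-out : Outside x
      x-out = x≢p ∷ x≢q ∷ x≢r ∷ []
      y-out : Outside y
      y-out = y≢p ∷ y≢q ∷ y≢r ∷ []
      w-out : Outside w
      w-out = w≢p ∷ w≢q ∷ w≢r ∷ []
      x≁q : NonEdge G x q
      x≁q = ¬edge⇒nonEdge (lonely-pq x-out (edge-sym px))
      x≁r : NonEdge G x r
      x≁r = ¬edge⇒nonEdge (lonely-pr x-out (edge-sym px))
      y≁p : NonEdge G y p
      y≁p = ¬edge⇒nonEdge (λ yp → lonely-pq y-out yp (edge-sym qy))
      y≁r : NonEdge G y r
      y≁r = ¬edge⇒nonEdge (lonely-qr y-out (edge-sym qy))
      w≁p : NonEdge G w p
      w≁p = ¬edge⇒nonEdge (λ wp → lonely-pr w-out wp (edge-sym rw))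
      w≁q : NonEdge G w q
      w≁q = ¬edge⇒nonEdge (λ wq → lonely-qr w-out wq (edge-sym rw))
      x≢y = edge-nonEdge⇒≢ px (nonEdge-sym y≁p)
      x≢w = edge-nonEdge⇒≢ px (nonEdge-sym w≁p)
      y≢w = edge-nonEdge⇒≢ qy (nonEdge-sym w≁q)
      p≢q = edge⇒≢ pq
      p≢r = edge⇒≢ pr
      q≢r = edge⇒≢ qr

      module Leaves (N[x] : N[ G ∣ x ]⊆ (p ∷ [])) (N[y] : N[ G ∣ y ]⊆ (q ∷ [])) where
        leaf : ∀ {u c j} → N[ G ∣ u ]⊆ (c ∷ []) → Edge G u j → j ≡ c
        leaf N[u] uj with N[u] _ uj
        ... | here j≡c = j≡c
        v-out : Outside v
        v-out = v≢p ∷ v≢q ∷ v≢r ∷ []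
        v≢x : v ≢ x
        v≢x refl = <⇒≱ v2 (degree-≤-length G R (p ∷ []) N[x])
        v≢y : v ≢ y
        v≢y refl = <⇒≱ v2 (degree-≤-length G R (q ∷ []) N[y])
        x∉N[v] : ∀ {c} → Edge G v c → c ≢ x
        x∉N[v] vc refl = v≢p (leaf N[x] (edge-sym vc))
        y∉N[v] : ∀ {c} → Edge G v c → c ≢ y
        y∉N[v] vc refl = v≢q (leaf N[y] (edge-sym vc))

        v≁p : NonEdge G v p
        v≁p = ¬edge⇒nonEdge absurd
          where
          absurd : Edge G v p → ⊥
          absurd vp with neighbour-outside G R (p ∷ []) v2
          ... | c , vc , c≢p ∷ [] =
                lonely-pq v-out vp (subst (Edge G v) (leaf N[y] (edge-sym (closed-pq (edge-sym vp) v-out qy y-out vc c≢p (y∉N[v] vc)))) vc)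

        v≁q : NonEdge G v q
        v≁q = ¬edge⇒nonEdge absurd
          where
          absurd : Edge G v q → ⊥
          absurd vq with neighbour-outside G R (q ∷ []) v2
          ... | c , vc , c≢q ∷ [] =
                edge-nonEdge-⊥ (subst (Edge G v) (leaf N[x] (edge-sym (closed-qp (edge-sym vq) v-out px x-out vc c≢q (x∉N[v] vc)))) vc) v≁p

        v≁r : NonEdge G v r
        v≁r = ¬edge⇒nonEdge absurd
          where
          absurd : Edge G v r → ⊥
          absurd vr with neighbour-outside G R (r ∷ []) v2
          ... | c , vc , c≢r ∷ [] =
                edge-nonEdge-⊥ (subst (Edge G v) (leaf N[x] (edge-sym (closed-rp (edge-sym vr) v-out px x-out vc c≢r (x∉N[v] vc)))) vc) v≁p

        -- The switches (px)(va) and (qy)(vb) make v a common neighbour of p and q.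
        pendant-diamond : Realizable PendantDiamond
        pendant-diamond with neighbour-outside G R [] (positive v)
        ... | a , va , [] with neighbour-outside G R (a ∷ []) v2
        ...   | b , vb , b≢a ∷ [] =
                diamond⇒pendantDiamond G₂ (switch-realizes S₂ R₁)
                  (diamond (kept₂ p∉₂ (edge-sym (kept₁ q∉₁ (edge-sym pq)))) (kept₂ p∉₂ (edge-sym (kept₁ r∉₁ (edge-sym pr))))
                           (kept₂ p∉₂ (switch-adds-ac S₁)) (edge-sym (kept₂ r∉₂ (kept₁ r∉₁ (edge-sym qr))))
                           (switch-adds-ac S₂) (≢-sym v≢r)) r3
          where
          a≢p = edge-nonEdge⇒≢ va v≁p
          a≢q = edge-nonEdge⇒≢ va v≁q
          a≢r = edge-nonEdge⇒≢ va v≁r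
          b≢p = edge-nonEdge⇒≢ vb v≁p
          b≢r = edge-nonEdge⇒≢ vb v≁r
          S₁ : Switchable G p x v a
          S₁ = switchable px va (nonEdge-sym v≁p) (¬edge⇒nonEdge (a≢p ∘ leaf N[x])) (≢-sym v≢p) (≢-sym (x∉N[v] va))
          G₁ = switch G p x v a
          R₁ = switch-realizes S₁ R
          kept₁ : ∀ {u c} → All (u ≢_) (p ∷ x ∷ v ∷ a ∷ []) → Edge G u c → Edge G₁ u c
          kept₁ = switch-keeps-edge-from G p x v a
          q∉₁ = ≢-sym p≢q ∷ ≢-sym x≢q ∷ ≢-sym v≢q ∷ ≢-sym a≢q ∷ []
          r∉₁ = ≢-sym p≢r ∷ ≢-sym x≢r ∷ ≢-sym v≢r ∷ ≢-sym a≢r ∷ []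
          y∉₁ = y≢p ∷ ≢-sym x≢y ∷ ≢-sym v≢y ∷ ≢-sym (y∉N[v] va) ∷ []
          S₂ : Switchable G₁ q y v b
          S₂ = switchable (kept₁ q∉₁ qy) (switch-keeps-edge G p x v a vb (x∉ab v≢p v≢x) (b∉xy (edge⇒≢ va) b≢a))
                          (switch-keeps-nonEdge-from G p x v a q∉₁ (nonEdge-sym v≁q))
                          (switch-keeps-nonEdge-from G p x v a y∉₁ (¬edge⇒nonEdge (edge-nonEdge⇒≢ vb v≁q ∘ leaf N[y])))
                          (≢-sym v≢q) (≢-sym (y∉N[v] vb))
          G₂ = switch G₁ q y v b
          kept₂ : ∀ {u c} → All (u ≢_) (q ∷ y ∷ v ∷ b ∷ []) → Edge G₁ u c → Edge G₂ u c
          kept₂ = switch-keeps-edge-from G₁ q y v b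
          p∉₂ = p≢q ∷ ≢-sym y≢p ∷ ≢-sym v≢p ∷ ≢-sym b≢p ∷ []
          r∉₂ = ≢-sym q≢r ∷ ≢-sym y≢r ∷ ≢-sym v≢r ∷ ≢-sym b≢r ∷ []

      nonadjacent⇒pendantDiamond : NonEdge G x y → Realizable PendantDiamond
      nonadjacent⇒pendantDiamond x≁y with neighbours-covered-or-escape G x (p ∷ []) | neighbours-covered-or-escape G y (q ∷ [])
      ... | inj₂ (t , xt , t≢p ∷ []) | _ =
            triangle-path⇒pendantDiamond G R pq pr qr q3 r3 px x≢q x≢r x≁q x≁r x≁y x≁w qy y≢r y≁r rw w≢p w≢q xt ty t≢p t≁p
        where
        ty : Edge G t y
        ty = closed-pq px x-out qy y-out xt t≢p (edge-nonEdge⇒≢ xt x≁y)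
        x≁w : NonEdge G x w
        x≁w = ¬edge⇒nonEdge (λ xw → edge-nonEdge-⊥ (closed-rq rw w-out qy y-out (edge-sym xw) x≢r x≢y) x≁y)
        t-out : Outside t
        t-out = t≢p ∷ edge-nonEdge⇒≢ xt x≁q ∷ edge-nonEdge⇒≢ xt x≁r ∷ []
        t≁p : NonEdge G t p
        t≁p = ¬edge⇒nonEdge (λ tp → edge-nonEdge-⊥ (closed-pr (edge-sym tp) t-out rw w-out (edge-sym xt) x≢p x≢w) x≁w)
      ... | inj₁ _ | inj₂ (t , yt , t≢q ∷ []) =
            triangle-path⇒pendantDiamond G R (edge-sym pq) qr pr p3 r3
              qy y≢p y≢r y≁p y≁r y≁x y≁w px x≢r x≁r rw w≢q w≢p yt tx t≢q t≁q
        where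
        y≁x = nonEdge-sym x≁y
        tx : Edge G t x
        tx = closed-qp qy y-out px x-out yt t≢q (edge-nonEdge⇒≢ yt y≁x)
        y≁w : NonEdge G y w
        y≁w = ¬edge⇒nonEdge (λ yw → edge-nonEdge-⊥ (closed-rp rw w-out px x-out (edge-sym yw) y≢r (≢-sym x≢y)) y≁x)
        t-out : Outside t
        t-out = edge-nonEdge⇒≢ yt y≁p ∷ t≢q ∷ edge-nonEdge⇒≢ yt y≁r ∷ []
        t≁q : NonEdge G t q
        t≁q = ¬edge⇒nonEdge (λ tq → edge-nonEdge-⊥ (closed-qr (edge-sym tq) t-out rw w-out (edge-sym yt) y≢q y≢w) y≁w)
      ... | inj₁ N[x] | inj₁ N[y] = Leaves.pendant-diamond N[x] N[y]

      module SecondTriangle (xy : Edge G x y) where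
        xw : Edge G x w
        xw = closed-qr qy y-out rw w-out (edge-sym xy) x≢q x≢w
        yw : Edge G y w
        yw = closed-pr px x-out rw w-out xy y≢p y≢w

        -- The neighbourhoods below make p q r x y w a 3-regular component (a prism).
        module Prism (N[x] : N[ G ∣ x ]⊆ (p ∷ y ∷ w ∷ [])) where
          N[y] : N[ G ∣ y ]⊆ (q ∷ x ∷ w ∷ [])
          N[y] = neighbours-within _ escape
            where
            escape : ∀ {t} → Edge G y t → All (t ≢_) (q ∷ x ∷ w ∷ []) → ⊥
            escape yt (t≢q ∷ t≢x ∷ t≢w ∷ []) =
              All¬⇒¬Any (edge-nonEdge⇒≢ yt y≁p ∷ ≢-sym (edge⇒≢ yt) ∷ t≢w ∷ [])
                (N[x] _ (edge-sym (closed-qp qy y-out px x-out yt t≢q t≢x)))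
          N[w] : N[ G ∣ w ]⊆ (r ∷ x ∷ y ∷ [])
          N[w] = neighbours-within _ escape
            where
            escape : ∀ {t} → Edge G w t → All (t ≢_) (r ∷ x ∷ y ∷ []) → ⊥
            escape wt (t≢r ∷ t≢x ∷ t≢y ∷ []) =
              All¬⇒¬Any (edge-nonEdge⇒≢ wt w≁p ∷ t≢y ∷ ≢-sym (edge⇒≢ wt) ∷ [])
                (N[x] _ (edge-sym (closed-rp rw w-out px x-out wt t≢r t≢x)))
          N[p] : N[ G ∣ p ]⊆ (q ∷ r ∷ x ∷ [])
          N[p] = neighbours-within _ escape
            where
            escape : ∀ {t} → Edge G p t → All (t ≢_) (q ∷ r ∷ x ∷ []) → ⊥
            escape pt (t≢q ∷ t≢r ∷ t≢x ∷ []) =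
              All¬⇒¬Any (≢-sym (edge⇒≢ pt) ∷ edge-nonEdge⇒≢ pt (nonEdge-sym y≁p) ∷ edge-nonEdge⇒≢ pt (nonEdge-sym w≁p) ∷ [])
                (N[x] _ (closed-qp qy y-out pt (≢-sym (edge⇒≢ pt) ∷ t≢q ∷ t≢r ∷ []) (edge-sym xy) x≢q (≢-sym t≢x)))
          N[q] : N[ G ∣ q ]⊆ (p ∷ r ∷ y ∷ [])
          N[q] = neighbours-within _ escape
            where
            escape : ∀ {t} → Edge G q t → All (t ≢_) (p ∷ r ∷ y ∷ []) → ⊥
            escape qt (t≢p ∷ t≢r ∷ t≢y ∷ []) =
              All¬⇒¬Any (≢-sym (edge⇒≢ qt) ∷ edge-nonEdge⇒≢ qt (nonEdge-sym x≁q) ∷ edge-nonEdge⇒≢ qt (nonEdge-sym w≁q) ∷ [])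
                (N[y] _ (closed-pq px x-out qt (t≢p ∷ ≢-sym (edge⇒≢ qt) ∷ t≢r ∷ []) xy y≢p (≢-sym t≢y)))
          N[r] : N[ G ∣ r ]⊆ (p ∷ q ∷ w ∷ [])
          N[r] = neighbours-within _ escape
            where
            escape : ∀ {t} → Edge G r t → All (t ≢_) (p ∷ q ∷ w ∷ []) → ⊥
            escape rt (t≢p ∷ t≢q ∷ t≢w ∷ []) =
              All¬⇒¬Any (≢-sym (edge⇒≢ rt) ∷ edge-nonEdge⇒≢ rt (nonEdge-sym x≁r) ∷ edge-nonEdge⇒≢ rt (nonEdge-sym y≁r) ∷ [])
                (N[w] _ (closed-pr px x-out rt (t≢p ∷ t≢q ∷ ≢-sym (edge⇒≢ rt) ∷ []) xw w≢p (≢-sym t≢w)))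

          prism-vertices : List (Fin n)
          prism-vertices = p ∷ q ∷ r ∷ x ∷ y ∷ w ∷ []

          prism-unique : Unique prism-vertices
          prism-unique = (p≢q ∷ p≢r ∷ ≢-sym x≢p ∷ ≢-sym y≢p ∷ ≢-sym w≢p ∷ [])
                       ∷ (q≢r ∷ ≢-sym x≢q ∷ ≢-sym y≢q ∷ ≢-sym w≢q ∷ [])
                       ∷ (≢-sym x≢r ∷ ≢-sym y≢r ∷ ≢-sym w≢r ∷ [])
                       ∷ (x≢y ∷ x≢w ∷ []) ∷ (y≢w ∷ []) ∷ [] ∷ []

          prism-cubic : All (λ u → d u ≡ 3) prism-vertices
          prism-cubic = degree≡3 G R N[p] pq pr px q≢r (≢-sym x≢q) (≢-sym x≢r)
                      ∷ degree≡3 G R N[q] (edge-sym pq) qr qy p≢r (≢-sym y≢p) (≢-sym y≢r)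
                      ∷ degree≡3 G R N[r] (edge-sym pr) (edge-sym qr) rw p≢q (≢-sym w≢p) (≢-sym w≢q)
                      ∷ degree≡3 G R N[x] (edge-sym px) xy xw (≢-sym y≢p) (≢-sym w≢p) y≢w
                      ∷ degree≡3 G R N[y] (edge-sym qy) (edge-sym xy) yw (≢-sym x≢q) (≢-sym w≢q) x≢w
                      ∷ degree≡3 G R N[w] (edge-sym rw) (edge-sym xw) (edge-sym yw) (≢-sym x≢r) (≢-sym y≢r) x≢y ∷ []

          spanning-prism-is-3⁶ : (∀ u → u ∈ prism-vertices) → n ≡ 6 × (∀ i → d i ≡ 3)
          spanning-prism-is-3⁶ covered =
            ≤-antisym (covering⇒length≥ _ covered) (unique⇒length≤ prism-unique) , λ i → All.lookup prism-cubic (covered i)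

          -- An edge uu′ away from the prism: trade xy, uu′ for xu, yu′, then rw, xu for rx, wu.
          edge-off-prism⇒pendantDiamond : ∀ {u} → All (u ≢_) prism-vertices → Realizable PendantDiamond
          edge-off-prism⇒pendantDiamond {u} (u≢p ∷ u≢q ∷ u≢r ∷ u≢x ∷ u≢y ∷ u≢w ∷ [])
            with neighbour-outside G R [] (positive u)
          ... | u′ , uu′ , [] =
                diamond⇒pendantDiamond G₂ (switch-realizes S₂ R₁)
                  (diamond (kept₂ p∉₂ (kept₁ p∉₁ pr)) (kept₂ p∉₂ (kept₁ p∉₁ pq)) (kept₂ p∉₂ (kept₁ p∉₁ px))
                           (edge-sym (kept₂ q∉₂ (edge-sym (kept₁ r∉₁ (edge-sym qr))))) (switch-adds-ac S₂) (≢-sym x≢q)) q3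
            where
            u′∉ : ∀ {c L} → N[ G ∣ c ]⊆ L → All (u ≢_) L → u′ ≢ c
            u′∉ N[c] u∉L refl = All¬⇒¬Any u∉L (N[c] u (edge-sym uu′))
            u′≢p = u′∉ N[p] (u≢q ∷ u≢r ∷ u≢x ∷ [])
            u′≢q = u′∉ N[q] (u≢p ∷ u≢r ∷ u≢y ∷ [])
            u′≢r = u′∉ N[r] (u≢p ∷ u≢q ∷ u≢w ∷ [])
            u′≢x = u′∉ N[x] (u≢p ∷ u≢y ∷ u≢w ∷ [])
            u′≢w = u′∉ N[w] (u≢r ∷ u≢x ∷ u≢y ∷ [])
            u′≢y = u′∉ N[y] (u≢q ∷ u≢x ∷ u≢w ∷ [])
            S₁ : Switchable G x y u u′
            S₁ = switchable xy uu′ (not-neighbour N[x] (u≢p ∷ u≢y ∷ u≢w ∷ [])) (not-neighbour N[y] (u′≢q ∷ u′≢x ∷ u′≢w ∷ []))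
                            (≢-sym u≢x) (≢-sym u′≢y)
            G₁ = switch G x y u u′
            R₁ = switch-realizes S₁ R
            kept₁ : ∀ {c e} → All (c ≢_) (x ∷ y ∷ u ∷ u′ ∷ []) → Edge G c e → Edge G₁ c e
            kept₁ = switch-keeps-edge-from G x y u u′
            p∉₁ = ≢-sym x≢p ∷ ≢-sym y≢p ∷ ≢-sym u≢p ∷ ≢-sym u′≢p ∷ []
            r∉₁ = ≢-sym x≢r ∷ ≢-sym y≢r ∷ ≢-sym u≢r ∷ ≢-sym u′≢r ∷ []
            w∉₁ = ≢-sym x≢w ∷ ≢-sym y≢w ∷ ≢-sym u≢w ∷ ≢-sym u′≢w ∷ []
            S₂ : Switchable G₁ r w x u
            S₂ = switchable (kept₁ r∉₁ rw) (switch-adds-ac S₁)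
                            (switch-keeps-nonEdge-from G x y u u′ r∉₁ (nonEdge-sym x≁r))
                            (switch-keeps-nonEdge-from G x y u u′ w∉₁ (not-neighbour N[w] (u≢r ∷ u≢x ∷ u≢y ∷ [])))
                            (≢-sym x≢r) (≢-sym u≢w)
            G₂ = switch G₁ r w x u
            kept₂ : ∀ {c e} → All (c ≢_) (r ∷ w ∷ x ∷ u ∷ []) → Edge G₁ c e → Edge G₂ c e
            kept₂ = switch-keeps-edge-from G₁ r w x u
            p∉₂ = p≢r ∷ ≢-sym w≢p ∷ ≢-sym x≢p ∷ ≢-sym u≢p ∷ []
            q∉₂ = q≢r ∷ ≢-sym w≢q ∷ ≢-sym x≢q ∷ ≢-sym u≢q ∷ []

          pendant-diamond : Realizable PendantDiamond
          pendant-diamond with vertices-covered-or-escape prism-vertices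
          ... | inj₁ covered    = ⊥-elim (not-3⁶ (spanning-prism-is-3⁶ covered))
          ... | inj₂ (u , u∉)   = edge-off-prism⇒pendantDiamond u∉

        pendant-diamond : Realizable PendantDiamond
        pendant-diamond with neighbours-covered-or-escape G x (p ∷ y ∷ w ∷ [])
        ... | inj₁ N[x] = Prism.pendant-diamond N[x]
        ... | inj₂ (t , xt , t≢p ∷ t≢y ∷ t≢w ∷ []) =
              diamond⇒pendantDiamond G R (diamond xy xw xt yw (edge-sym (closed-pq px x-out qy y-out xt t≢p t≢y)) (≢-sym t≢w))
                (degree≥3 G R (edge-sym rw) (edge-sym xw) (edge-sym yw) (≢-sym x≢r) (≢-sym y≢r) x≢y)

      pendant-diamond : Realizable PendantDiamond
      pendant-diamond with edge-or-nonEdge G x y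
      ... | inj₁ xy  = SecondTriangle.pendant-diamond xy
      ... | inj₂ x≁y = nonadjacent⇒pendantDiamond x≁y

    all-closed⇒pendantDiamond : Closed p q → Closed q p → Closed p r → Closed r p → Closed q r → Closed r q → Realizable PendantDiamond
    all-closed⇒pendantDiamond closed-pq closed-qp closed-pr closed-rp closed-qr closed-rq
      with neighbour-outside G R (q ∷ r ∷ []) p3 | neighbour-outside G R (p ∷ r ∷ []) q3 | neighbour-outside G R (p ∷ q ∷ []) r3
    ... | x , px , x≢q ∷ x≢r ∷ [] | y , qy , y≢p ∷ y≢r ∷ [] | w , rw , w≢p ∷ w≢q ∷ [] =
          PrivateNeighbours.pendant-diamond closed-pq closed-qp closed-pr closed-rp closed-qr closed-rq px x≢q x≢r qy y≢p y≢r rw w≢p w≢q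

    pendant-diamond : Realizable PendantDiamond
    pendant-diamond with closed-or-pendantDiamond pq pr qr r3
                (λ { (a≢p ∷ a≢q ∷ a≢r ∷ []) → a≢p , a≢q , a≢r })
                (λ oa pa → ¬edge⇒nonEdge (lonely-pq oa (edge-sym pa)))
            | closed-or-pendantDiamond (edge-sym pq) qr pr r3
                (λ { (a≢p ∷ a≢q ∷ a≢r ∷ []) → a≢q , a≢p , a≢r })
                (λ oa qa → ¬edge⇒nonEdge (λ ap → lonely-pq oa ap (edge-sym qa)))
            | closed-or-pendantDiamond pr pq (edge-sym qr) q3
                (λ { (a≢p ∷ a≢q ∷ a≢r ∷ []) → a≢p , a≢r , a≢q })
                (λ oa pa → ¬edge⇒nonEdge (lonely-pr oa (edge-sym pa)))
            | closed-or-pendantDiamond (edge-sym pr) (edge-sym qr) pq q3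
                (λ { (a≢p ∷ a≢q ∷ a≢r ∷ []) → a≢r , a≢p , a≢q })
                (λ oa ra → ¬edge⇒nonEdge (λ ap → lonely-pr oa ap (edge-sym ra)))
            | closed-or-pendantDiamond qr (edge-sym pq) (edge-sym pr) p3
                (λ { (a≢p ∷ a≢q ∷ a≢r ∷ []) → a≢q , a≢r , a≢p })
                (λ oa qa → ¬edge⇒nonEdge (lonely-qr oa (edge-sym qa)))
            | closed-or-pendantDiamond (edge-sym qr) (edge-sym pr) (edge-sym pq) p3
                (λ { (a≢p ∷ a≢q ∷ a≢r ∷ []) → a≢r , a≢q , a≢p })
                (λ oa ra → ¬edge⇒nonEdge (λ aq → lonely-qr oa aq (edge-sym ra)))
    ... | inj₁ found | _ | _ | _ | _ | _ = found
    ... | _ | inj₁ found | _ | _ | _ | _ = found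
    ... | _ | _ | inj₁ found | _ | _ | _ = found
    ... | _ | _ | _ | inj₁ found | _ | _ = found
    ... | _ | _ | _ | _ | inj₁ found | _ = found
    ... | _ | _ | _ | _ | _ | inj₁ found = found
    ... | inj₂ c-pq | inj₂ c-qp | inj₂ c-pr | inj₂ c-rp | inj₂ c-qr | inj₂ c-rq =
          all-closed⇒pendantDiamond c-pq c-qp c-pr c-rp c-qr c-rq

  triangle⇒pendantDiamond : ∀ G → Realizes G d → ∀ {p q r} → Edge G p q → Edge G p r → Edge G q r →
                            3 ≤ d p → 3 ≤ d q → 3 ≤ d r →
                            ∀ {v} → v ≢ p → v ≢ q → v ≢ r → 2 ≤ d v → Realizable PendantDiamond
  triangle⇒pendantDiamond G R {p} {q} {r} pq pr qr p3 q3 r3 v≢p v≢q v≢r v2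
    with any? (λ a → avoids? a (p ∷ q ∷ r ∷ []) ×-dec edge? G a p ×-dec edge? G a q)
       | any? (λ a → avoids? a (p ∷ q ∷ r ∷ []) ×-dec edge? G a p ×-dec edge? G a r)
       | any? (λ a → avoids? a (p ∷ q ∷ r ∷ []) ×-dec edge? G a q ×-dec edge? G a r)
  ... | yes (a , _ ∷ _ ∷ a≢r ∷ [] , ap , aq) | _ | _ =
        diamond⇒pendantDiamond G R (diamond pq pr (edge-sym ap) qr (edge-sym aq) (≢-sym a≢r)) r3
  ... | _ | yes (a , _ ∷ a≢q ∷ _ ∷ [] , ap , ar) | _ =
        diamond⇒pendantDiamond G R (diamond pr pq (edge-sym ap) (edge-sym qr) (edge-sym ar) (≢-sym a≢q)) q3
  ... | _ | _ | yes (a , a≢p ∷ _ ∷ _ ∷ [] , aq , ar) =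
        diamond⇒pendantDiamond G R (diamond qr (edge-sym pq) (edge-sym aq) (edge-sym pr) (edge-sym ar) (≢-sym a≢p)) p3
  ... | no ¬pq | no ¬pr | no ¬qr =
        TriangleWithoutCommonNeighbours.pendant-diamond G R pq pr qr p3 q3 r3 v≢p v≢q v≢r v2
          (λ oa ap aq → ¬pq (_ , oa , ap , aq)) (λ oa ap ar → ¬pr (_ , oa , ap , ar)) (λ oa aq ar → ¬qr (_ , oa , aq , ar))

  module _ {W : List (Fin n)} (W-unique : Unique W) (3<|W| : 3 < length W) (W-degrees : All (λ v → 2 ≤ d v) W) where

    large-triangle⇒pendantDiamond : ∀ G → Realizes G d → ∀ {a b c} → Edge G a b → Edge G a c → Edge G b c →
                                    3 ≤ d a → 3 ≤ d b → 3 ≤ d c → Realizable PendantDiamond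
    large-triangle⇒pendantDiamond G R {a} {b} {c} ab ac bc a3 b3 c3 with member-outside (a ∷ b ∷ c ∷ []) W-unique 3<|W|
    ... | v , v∈W , v≢a ∷ v≢b ∷ v≢c ∷ [] =
          triangle⇒pendantDiamond G R ab ac bc a3 b3 c3 v≢a v≢b v≢c (All.lookup W-degrees v∈W)

    separated-pair⇒pendantDiamond : ∀ G → Realizes G d → ∀ {c e₁ e₂} → NonEdge G e₁ e₂ → 3 ≤ d e₁ → 3 ≤ d e₂ →
                                    (∀ {a b} → Edge G e₁ a → a ≢ c → Edge G e₂ b → b ≢ c → a ≢ b → Edge G a b) →
                                    (∀ {j} → Edge G e₁ j → Edge G e₂ j → j ≢ c → ⊥) → Realizable PendantDiamond
    separated-pair⇒pendantDiamond G R {c} {e₁} {e₂} e₁≁e₂ e₁3 e₂3 complete no-common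
      with neighbour-outside G R (c ∷ []) (≤-trans (n≤1+n 2) e₁3) | neighbour-outside G R (c ∷ []) (≤-trans (n≤1+n 2) e₂3)
    ... | a₁ , e₁a₁ , a₁≢c ∷ [] | b₁ , e₂b₁ , b₁≢c ∷ []
      with neighbour-outside G R (c ∷ a₁ ∷ []) e₁3 | neighbour-outside G R (c ∷ b₁ ∷ []) e₂3
    ... | a₂ , e₁a₂ , a₂≢c ∷ a₂≢a₁ ∷ [] | b₂ , e₂b₂ , b₂≢c ∷ b₂≢b₁ ∷ [] = by-cases (edge-or-nonEdge G a₁ a₂)
      where
      apart : ∀ {a b} → Edge G e₁ a → a ≢ c → Edge G e₂ b → a ≢ b
      apart e₁a a≢c e₂b refl = no-common e₁a e₂b a≢c
      e₁≢ : ∀ {b} → Edge G e₂ b → e₁ ≢ b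
      e₁≢ e₂b = ≢-sym (edge-nonEdge⇒≢ e₂b (nonEdge-sym e₁≁e₂))
      e₂≢ : ∀ {a} → Edge G e₁ a → e₂ ≢ a
      e₂≢ e₁a = ≢-sym (edge-nonEdge⇒≢ e₁a e₁≁e₂)
      a₁≢b₁ = apart e₁a₁ a₁≢c e₂b₁
      a₂≢b₁ = apart e₁a₂ a₂≢c e₂b₁
      a₁b₁ = complete e₁a₁ a₁≢c e₂b₁ b₁≢c a₁≢b₁
      a₁b₂ = complete e₁a₁ a₁≢c e₂b₂ b₂≢c (apart e₁a₁ a₁≢c e₂b₂)
      a₂b₁ = complete e₁a₂ a₂≢c e₂b₁ b₁≢c a₂≢b₁
      a₂b₂ = complete e₁a₂ a₂≢c e₂b₂ b₂≢c (apart e₁a₂ a₂≢c e₂b₂)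
      by-cases : Edge G a₁ a₂ ⊎ NonEdge G a₁ a₂ → Realizable PendantDiamond
      by-cases (inj₁ a₁a₂) =
        large-triangle⇒pendantDiamond G R a₁a₂ a₁b₁ a₂b₁
          (degree≥3 G R (edge-sym e₁a₁) a₁a₂ a₁b₁ (edge⇒≢ e₁a₂) (e₁≢ e₂b₁) a₂≢b₁)
          (degree≥3 G R (edge-sym e₁a₂) (edge-sym a₁a₂) a₂b₁ (edge⇒≢ e₁a₁) (e₁≢ e₂b₁) a₁≢b₁)
          (degree≥3 G R (edge-sym e₂b₁) (edge-sym a₁b₁) (edge-sym a₂b₁) (e₂≢ e₁a₁) (e₂≢ e₁a₂) (≢-sym a₂≢a₁))
      by-cases (inj₂ a₁≁a₂) =
        large-triangle⇒pendantDiamond (switch G e₁ a₁ b₁ a₂) (switch-realizes S R) (switch-adds-be S)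
          (switch-keeps-edge G e₁ a₁ b₁ a₂ a₁b₂ (a∉xy (≢-sym (edge⇒≢ e₁a₁)) (≢-sym (e₁≢ e₂b₂)))
                                                (x∉ab a₁≢b₁ (≢-sym a₂≢a₁)))
          (switch-keeps-edge G e₁ a₁ b₁ a₂ a₂b₂ (x∉ab (≢-sym (edge⇒≢ e₁a₂)) a₂≢a₁) (a∉xy a₂≢b₁ b₂≢b₁))
          (degree≥3 G R (edge-sym e₁a₁) a₁b₁ a₁b₂ (e₁≢ e₂b₁) (e₁≢ e₂b₂) (≢-sym b₂≢b₁))
          (degree≥3 G R (edge-sym e₁a₂) a₂b₁ a₂b₂ (e₁≢ e₂b₁) (e₁≢ e₂b₂) (≢-sym b₂≢b₁))
          (degree≥3 G R (edge-sym e₂b₂) (edge-sym a₁b₂) (edge-sym a₂b₂) (e₂≢ e₁a₁) (e₂≢ e₁a₂) (≢-sym a₂≢a₁))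
        where
        S : Switchable G e₁ a₁ b₁ a₂
        S = switchable e₁a₁ (edge-sym a₂b₁) (¬edge⇒nonEdge (λ e₁b₁ → no-common e₁b₁ e₂b₁ b₁≢c)) a₁≁a₂
                       (e₁≢ e₂b₁) (≢-sym a₂≢a₁)

    Joined : Graph n → Fin n → Fin n → Fin n → Graph n → Set
    Joined G c e₁ e₂ G′ = Edge G′ e₁ e₂ × (Edge G e₁ c → Edge G′ e₁ c) × (Edge G e₂ c → Edge G′ e₂ c)

    join-or-complete : ∀ G → Realizes G d → ∀ {c e₁ e₂} → NonEdge G e₁ e₂ → e₁ ≢ e₂ →
                       Realizable (Joined G c e₁ e₂)
                       ⊎ (∀ {a b} → Edge G e₁ a → a ≢ c → Edge G e₂ b → b ≢ c → a ≢ b → Edge G a b)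
    join-or-complete G R {c} {e₁} {e₂} e₁≁e₂ e₁≢e₂
      with any? (λ a → any? (λ b → edge? G e₁ a ×-dec ¬? (a ≟ c) ×-dec edge? G e₂ b ×-dec ¬? (b ≟ c) ×-dec
                                   ¬? (a ≟ b) ×-dec ¬? (edge? G a b)))
    ... | yes (a , b , e₁a , a≢c , e₂b , b≢c , a≢b , ¬ab) =
          inj₁ (switch G e₁ a e₂ b , switch-realizes S R , switch-adds-ac S ,
                (λ e₁c → switch-keeps-edge G e₁ a e₂ b e₁c (b∉xy (edge⇒≢ e₁a) (≢-sym a≢c))
                           (x∉ab e₁≢e₂ (≢-sym (edge-nonEdge⇒≢ e₂b (nonEdge-sym e₁≁e₂))))) ,
                (λ e₂c → switch-keeps-edge G e₁ a e₂ b e₂c (x∉ab (≢-sym e₁≢e₂) (≢-sym (edge-nonEdge⇒≢ e₁a e₁≁e₂)))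
                           (b∉xy (edge⇒≢ e₂b) (≢-sym b≢c))))
      where
      S : Switchable G e₁ a e₂ b
      S = switchable e₁a e₂b e₁≁e₂ (¬edge⇒nonEdge ¬ab) e₁≢e₂ a≢b
    ... | no none = inj₂ complete
      where
      complete : ∀ {a b} → Edge G e₁ a → a ≢ c → Edge G e₂ b → b ≢ c → a ≢ b → Edge G a b
      complete {a} {b} e₁a a≢c e₂b b≢c a≢b with edge? G a b
      ... | yes ab = ab
      ... | no ¬ab = ⊥-elim (none (a , b , e₁a , a≢c , e₂b , b≢c , a≢b , ¬ab))

    common-neighbour? : ∀ G (c e₁ e₂ : Fin n) → Dec (∃ λ j → Edge G e₁ j × Edge G e₂ j × j ≢ c)
    common-neighbour? G c e₁ e₂ = any? (λ j → edge? G e₁ j ×-dec edge? G e₂ j ×-dec ¬? (j ≟ c))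

    -- The common neighbour c′, a further neighbour a of e₁ and e₁ span a triangle of large vertices.
    common-neighbour⇒pendantDiamond : ∀ G → Realizes G d → ∀ {c c′ e₁ e₂} → NonEdge G e₁ e₂ → e₁ ≢ e₂ →
                                      3 ≤ d e₁ → 3 ≤ d e₂ →
                                      (∀ {a b} → Edge G e₁ a → a ≢ c → Edge G e₂ b → b ≢ c → a ≢ b → Edge G a b) →
                                      Edge G e₁ c′ → Edge G e₂ c′ → c′ ≢ c → Realizable PendantDiamond
    common-neighbour⇒pendantDiamond G R {c} {c′} {e₁} {e₂} e₁≁e₂ e₁≢e₂ e₁3 e₂3 complete e₁c′ e₂c′ c′≢c
      with neighbour-outside G R (c ∷ c′ ∷ []) e₁3 | neighbour-outside G R (c ∷ c′ ∷ []) e₂3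
    ... | a , e₁a , a≢c ∷ a≢c′ ∷ [] | b , e₂b , b≢c ∷ b≢c′ ∷ [] =
          large-triangle⇒pendantDiamond G R e₁a e₁c′ ac′ e₁3 a3
            (degree≥3 G R (edge-sym e₁c′) (edge-sym e₂c′) (edge-sym ac′)
                          e₁≢e₂ (edge⇒≢ e₁a) (≢-sym (edge-nonEdge⇒≢ e₁a e₁≁e₂)))
      where
      ac′ = complete e₁a a≢c e₂c′ c′≢c a≢c′
      a3 : 3 ≤ d a
      a3 with b ≟ a
      ... | yes refl = degree≥3 G R (edge-sym e₁a) ac′ (edge-sym e₂b) (edge⇒≢ e₁c′) e₁≢e₂ (≢-sym (edge⇒≢ e₂c′))
      ... | no b≢a   = degree≥3 G R (edge-sym e₁a) ac′ (complete e₁a a≢c e₂b b≢c (≢-sym b≢a)) (edge⇒≢ e₁c′)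
                         (≢-sym (edge-nonEdge⇒≢ e₂b (nonEdge-sym e₁≁e₂))) (≢-sym b≢c′)

    join-or-pendantDiamond : ∀ G → Realizes G d → ∀ {c e₁ e₂} → NonEdge G e₁ e₂ → e₁ ≢ e₂ → 3 ≤ d e₁ → 3 ≤ d e₂ →
                             Realizable PendantDiamond ⊎ Realizable (Joined G c e₁ e₂)
    join-or-pendantDiamond G R {c} {e₁} {e₂} e₁≁e₂ e₁≢e₂ e₁3 e₂3 with join-or-complete G R {c} e₁≁e₂ e₁≢e₂
    ... | inj₁ joined = inj₂ joined
    ... | inj₂ complete with common-neighbour? G c e₁ e₂
    ...   | yes (c′ , e₁c′ , e₂c′ , c′≢c) =
            inj₁ (common-neighbour⇒pendantDiamond G R e₁≁e₂ e₁≢e₂ e₁3 e₂3 complete e₁c′ e₂c′ c′≢c)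
    ...   | no none =
            inj₁ (separated-pair⇒pendantDiamond G R e₁≁e₂ e₁3 e₂3 complete (λ e₁j e₂j j≢c → none (_ , e₁j , e₂j , j≢c)))

    cherry⇒pendantDiamond : ∀ G → Realizes G d → ∀ {c e₁ e₂} → Edge G c e₁ → Edge G c e₂ → e₁ ≢ e₂ →
                            3 ≤ d c → 3 ≤ d e₁ → 3 ≤ d e₂ → Realizable PendantDiamond
    cherry⇒pendantDiamond G R {c} {e₁} {e₂} ce₁ ce₂ e₁≢e₂ c3 e₁3 e₂3 with edge-or-nonEdge G e₁ e₂
    ... | inj₁ e₁e₂ = large-triangle⇒pendantDiamond G R ce₁ ce₂ e₁e₂ c3 e₁3 e₂3
    ... | inj₂ e₁≁e₂ with join-or-pendantDiamond G R {c} e₁≁e₂ e₁≢e₂ e₁3 e₂3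
    ...   | inj₁ found = found
    ...   | inj₂ (G′ , R′ , e₁e₂ , keeps₁ , keeps₂) =
            large-triangle⇒pendantDiamond G′ R′ (edge-sym (keeps₁ (edge-sym ce₁))) (edge-sym (keeps₂ (edge-sym ce₂))) e₁e₂
              c3 e₁3 e₂3

    large-edge⇒pendantDiamond : ∀ G → Realizes G d → ∀ {p q r} → Edge G p q → p ≢ r → q ≢ r →
                                3 ≤ d p → 3 ≤ d q → 3 ≤ d r → Realizable PendantDiamond
    large-edge⇒pendantDiamond G R {p} {q} {r} pq p≢r q≢r p3 q3 r3 with edge-or-nonEdge G q r
    ... | inj₁ qr  = cherry⇒pendantDiamond G R (edge-sym pq) qr p≢r q3 p3 r3
    ... | inj₂ q≁r with join-or-pendantDiamond G R {p} q≁r q≢r q3 r3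
    ...   | inj₁ found = found
    ...   | inj₂ (G′ , R′ , qr , keeps-qp , _) = cherry⇒pendantDiamond G′ R′ (keeps-qp (edge-sym pq)) qr p≢r q3 p3 r3

    three-large⇒pendantDiamond : ∀ G → Realizes G d → ∀ {p q r} → p ≢ q → p ≢ r → q ≢ r →
                                 3 ≤ d p → 3 ≤ d q → 3 ≤ d r → Realizable PendantDiamond
    three-large⇒pendantDiamond G R {p} {q} {r} p≢q p≢r q≢r p3 q3 r3 with edge-or-nonEdge G p q
    ... | inj₁ pq  = large-edge⇒pendantDiamond G R pq p≢r q≢r p3 q3 r3
    ... | inj₂ p≁q with join-or-pendantDiamond G R {r} p≁q p≢q p3 q3
    ...   | inj₁ found = found
    ...   | inj₂ (G′ , R′ , pq , _) = large-edge⇒pendantDiamond G′ R′ pq p≢r q≢r p3 q3 r3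

conditions⇒pendantDiamond : ∀ {m} {d : Seq (5 + m)} → Graphic d → NonIncreasing d → (∀ i → 1 ≤ d i) →
                            3 ≤ d (suc (suc zero)) → 2 ≤ d (suc (suc (suc zero))) → ¬ (5 + m ≡ 6 × (∀ i → d i ≡ 3)) →
                            Σ (Graph (5 + m)) λ G → Realizes G d × PendantDiamond G
conditions⇒pendantDiamond {m} {d} (G , R) nonIncreasing positive d₂≥3 d₃≥2 not-3⁶ =
  Sufficiency.three-large⇒pendantDiamond d positive (m≤m+n 5 m) not-3⁶ first-four-unique ≤-refl first-four≥2 G R
    (λ ()) (λ ()) (λ ()) (≤-trans d₂≥3 (nonIncreasing _ _ z≤n)) (≤-trans d₂≥3 (nonIncreasing _ _ (s≤s z≤n))) d₂≥3
  where
  first-four-unique : Unique (zero ∷ suc zero ∷ suc (suc zero) ∷ suc (suc (suc zero)) ∷ [])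
  first-four-unique = ((λ ()) ∷ (λ ()) ∷ (λ ()) ∷ []) ∷ ((λ ()) ∷ (λ ()) ∷ []) ∷ ((λ ()) ∷ []) ∷ [] ∷ []
  first-four≥2 : All (λ v → 2 ≤ d v) (zero ∷ suc zero ∷ suc (suc zero) ∷ suc (suc (suc zero)) ∷ [])
  first-four≥2 = ≤-trans d₃≥2 (nonIncreasing _ _ z≤n) ∷ ≤-trans d₃≥2 (nonIncreasing _ _ (s≤s z≤n))
               ∷ ≤-trans d₃≥2 (nonIncreasing _ _ (s≤s (s≤s z≤n))) ∷ d₃≥2 ∷ []

theorem2p2 : (m : ℕ) → (d : Seq (5 + m)) → Graphic d → NonIncreasing d →
    (∀ (i : Fin (5 + m)) → 1 ≤ d i) →
    (PotentiallyGraphic K5-Y4 d ⇔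
      ((3 ≤ d (suc (suc zero))) × (2 ≤ d (suc (suc (suc zero)))) × ¬ ((5 + m ≡ 6) × (∀ (i : Fin (5 + m)) → d i ≡ 3))))
theorem2p2 m d graphic nonIncreasing positive = mk⇔
  (λ (G , R , copy) → pendantDiamond⇒conditions nonIncreasing R (copy⇒pendantDiamond {G = G} copy))
  (λ (d₂≥3 , d₃≥2 , not-3⁶) →
     let G , R , P = conditions⇒pendantDiamond graphic nonIncreasing positive d₂≥3 d₃≥2 not-3⁶
     in  G , R , pendantDiamond⇒copy P)
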